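{- Let $u_0,u_1$ be bivariate integer polynomials and let $a_0,a_1$ be integers. Then there exists a GapL function $f$ such that for every integer $n\geq 1$ and every $c\in\{0,1\}$, \[ f(1^n,c)=\begin{cases} u_c\!\left(f(1^{\lceil n/2\rceil},0),\,f(1^{\lceil n/2\rceil},1)\right) & n\geq 2,\\ a_c & n=1.\end{cases} \]
   Context: A GapL function is a function $f:\Sigma^{\ast}\to\mathbb{Z}$ for which there is a nondeterministic Turing machine $M$ running in logarithmic space such that $f(x)$ equals the number of accepting computation paths of $M$ on $x$ minus the number of rejecting computation paths of $M$ on $x$, for every $x$. Functions of several arguments are understood via a standard encoding of tuples as strings. -}

module Defs where

open import Data.Bool using (Bool; true; false; if_then_else_)
open import Data.Nat as ℕ using (ℕ; zero; suc; _≤_; ⌈_/2⌉)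
open import Data.Nat.Logarithm using (⌊log₂_⌋)
open import Data.Integer as ℤ using (ℤ; +_; -_)
open import Data.Fin using (Fin)
import Data.Fin as Fin
open import Data.Maybe using (Maybe; just; nothing)
open import Data.List as List using (List; []; _∷_; _++_; length; replicate; lookup)
open import Data.List.NonEmpty as List⁺ using (List⁺)
open import Data.List.Relation.Unary.All using (All)
open import Data.Product using (Σ; ∃; _×_; _,_)
open import Data.Sum using (_⊎_)
open import Data.Unit using (⊤)
open import Data.Empty using (⊥)
open import Relation.Binary.PropositionalEquality using (_≡_)
open import Relation.Nullary.Decidable using (⌊_⌋; yes; no)

-- Strings are binary: Σ = {0,1}, encoded as Bool (false = 0, true = 1).
Str : Set
Str = List Bool

dbl : Str → Str
dbl []       = []
dbl (b ∷ bs) = b ∷ b ∷ dbl bs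

⟨_,_⟩ : Str → Str → Str
⟨ x , y ⟩ = dbl x ++ (false ∷ true ∷ []) ++ y

data Kind : Set where
  accepting rejecting running : Kind

data Move : Set where
  L S R : Move

-- Symbol seen by the input head: 'nothing' is an end marker.
InSym : Set
InSym = Maybe Bool

record NTM : Set where
  field
    nStates : ℕ
    nSyms   : ℕ                     -- work alphabet is Fin (suc nSyms), 0 = blank
    start   : Fin nStates
    kind    : Fin nStates → Kind
    -- transition relation (nonempty set of choices in each situation):
    -- (new state, symbol written on work tape, input head move, work head move)
    δ : Fin nStates → InSym → Fin (suc nSyms) →
        List⁺ (Fin nStates × Fin (suc nSyms) × Move × Move)

module _ (M : NTM) where
  open NTM M

  Γ : Set
  Γ = Fin (suc nSyms)

  record Config : Set where
    constructor cfg
    field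
      state : Fin nStates
      ipos  : ℕ            -- 0 = left end marker, 1..|x| = input, |x|+1 = right end marker
      wpos  : ℕ
      tape  : ℕ → Γ

  open Config

  initial : Config
  initial = cfg start 1 0 (λ _ → Fin.zero)

  readIn : Str → ℕ → InSym
  readIn x zero    = nothing
  readIn x (suc i) with i ℕ.<? length x
  ... | yes p = just (lookup x (Fin.fromℕ< p))
  ... | no  _ = nothing

  moveIn : Str → Move → ℕ → ℕ
  moveIn x L zero    = zero
  moveIn x L (suc i) = i
  moveIn x S i       = i
  moveIn x R i       = if ⌊ i ℕ.<? suc (length x) ⌋ then suc i else i

  moveW : Move → ℕ → ℕ
  moveW L zero    = zero
  moveW L (suc i) = i
  moveW S i       = i
  moveW R i       = suc i

  write : (ℕ → Γ) → ℕ → Γ → (ℕ → Γ)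
  write t p g j = if ⌊ j ℕ.≟ p ⌋ then g else t j

  succs : Str → Config → List Config
  succs x c = List.map step (List⁺.toList (δ (state c) (readIn x (ipos c)) (tape c (wpos c))))
    where
    step : Fin nStates × Γ × Move × Move → Config
    step (q , g , mi , mw) =
      cfg q (moveIn x mi (ipos c)) (moveW mw (wpos c)) (write (tape c) (wpos c) g)

  Bounded : Str → ℕ → ℕ → Config → Set
  Bounded x B zero    c with kind (state c)
  ... | running = ⊥
  ... | _       = wpos c ≤ B
  Bounded x B (suc t) c with kind (state c)
  ... | running = wpos c ≤ B × All (Bounded x B t) (succs x c)
  ... | _       = wpos c ≤ B

  gap : Str → ℕ → Config → ℤ
  gapList : Str → ℕ → List Config → ℤ
  gap x t c with kind (state c)
  gap x t       c | accepting = + 1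
  gap x t       c | rejecting = - (+ 1)
  gap x zero    c | running   = + 0
  gap x (suc t) c | running   = gapList x t (succs x c)
  gapList x t []       = + 0
  gapList x t (c ∷ cs) = gap x t c ℤ.+ gapList x t cs

-- Space bound k·(⌊log₂ n⌋ + 1) and time bound (n+1)^k (the latter only
-- to express "every computation path halts": a log-space machine all of
-- whose paths halt halts within polynomially many steps).
spaceB : ℕ → ℕ → ℕ
spaceB k n = k ℕ.* suc ⌊log₂ n ⌋

timeB : ℕ → ℕ → ℕ
timeB k n = suc n ℕ.^ k

GapL : (Str → ℤ) → Set
GapL f = Σ NTM λ M → Σ ℕ λ k → ∀ (x : Str) →
  Bounded M x (spaceB k (length x)) (timeB k (length x)) (initial M)
  × f x ≡ gap M x (timeB k (length x)) (initial M)

Poly2 : Set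
Poly2 = List (ℤ × ℕ × ℕ)

eval2 : Poly2 → ℤ → ℤ → ℤ
eval2 []                  x y = + 0
eval2 ((c , i , j) ∷ ps)  x y = c ℤ.* (x ℤ.^ i) ℤ.* (y ℤ.^ j) ℤ.+ eval2 ps x y

ones : ℕ → Str
ones n = replicate n true

bitStr : Bool → Str
bitStr c = c ∷ []

-- Unrolling the recursion gives f(1ⁿ, c) = V_c(ℓ(n − 1)), where ℓ is the binary length,
-- V_c(0) = a_c and V_c(d + 1) = u_c(V_0(d), V_1(d)); indeed ℓ(n − 1) = 1 + ℓ(⌈n/2⌉ − 1) for n ≥ 2.
-- A log-space machine produces V_c(ℓ(n − 1)) as its gap.  It first writes n − 1 in binary on the
-- work tape by counting the pairs 11 of the input after the first one, and then evaluates V_c(d)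
-- recursively, using the counter cells as a stack: the cell of level d records the exponents still
-- to be processed in the current monomial.  Sums are nondeterministic branchings (a coefficient k
-- becomes |k| branches, and negative ones run with accept and reject exchanged), while products are
-- sequential: evaluating V_c(d) in front of a continuation multiplies the gap of the continuation
-- by V_c(d).  The recursion depth ℓ(n − 1) ≤ log n + 1 bounds the space, and the running time is
-- polynomial since each level multiplies it by a constant only.

module Submission where

open import Defs
open import Function using (_∘_)
open import Data.Bool using (Bool; true; false; if_then_else_; not)
open import Data.Nat as ℕ using (ℕ; zero; suc; _≤_; _<_; _+_; _*_; _^_; _⊔_; z≤n; s≤s; ⌈_/2⌉; ⌊_/2⌋)
import Data.Nat.Properties as NP
open import Data.Nat.Logarithm using (⌊log₂_⌋; ⌊log₂⌋-mono-≤; ⌊log₂[2*b]⌋≡1+⌊log₂b⌋; ⌊log₂[2^n]⌋≡n)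
open import Data.Nat.Tactic.RingSolver using () renaming (solve-∀ to ℕ-solve)
open import Data.Integer as ℤ using (ℤ; +_; -_; -[1+_])
import Data.Integer.Properties as ZP
open import Data.Integer.Tactic.RingSolver using () renaming (solve-∀ to ℤ-solve)
open import Data.Fin as Fin using (Fin; inject₁; toℕ; _↑ˡ_; _↑ʳ_; splitAt; combine; remQuot)
open import Data.Fin.Properties using (toℕ-inject₁; splitAt-↑ˡ; splitAt-↑ʳ; remQuot-combine)
open import Data.Maybe using (just; nothing)
open import Data.List as List using (List; []; _∷_; _++_; length; replicate)
import Data.List.Properties as LP
import Data.List.NonEmpty.Properties as List⁺ₚ
open import Data.List.NonEmpty as List⁺ using (List⁺; _∷_; [_])
open import Data.List.Relation.Unary.All using (All; []; _∷_)
open import Data.List.Relation.Binary.Pointwise using (Pointwise; []; _∷_)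
open import Data.Product as Product using (Σ; _×_; _,_; proj₁; proj₂)
open import Data.Sum as Sum using (_⊎_; inj₁; inj₂)
open import Data.Unit using (⊤; tt)
open import Data.Empty using (⊥; ⊥-elim)
open import Relation.Binary.PropositionalEquality hiding ([_])
open import Relation.Nullary using (¬_)
open import Relation.Nullary.Decidable using (⌊_⌋; yes; no)

-- Finite types coded by Fin

data U : Set where
  𝟙 bool : U
  _⊕_ _⊗_ : U → U → U
  fin : ℕ → U
infixr 4 _⊕_
infixr 5 _⊗_

El : U → Set
El 𝟙 = ⊤
El bool = Bool
El (a ⊕ b) = El a ⊎ El b
El (a ⊗ b) = El a × El b
El (fin n) = Fin n

size : U → ℕ
size 𝟙 = 1
size bool = 2
size (a ⊕ b) = size a + size b
size (a ⊗ b) = size a * size b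
size (fin n) = n

encode : (a : U) → El a → Fin (size a)
encode 𝟙 tt = Fin.zero
encode bool false = Fin.zero
encode bool true = Fin.suc Fin.zero
encode (a ⊕ b) (inj₁ x) = encode a x ↑ˡ size b
encode (a ⊕ b) (inj₂ y) = size a ↑ʳ encode b y
encode (a ⊗ b) (x , y) = combine (encode a x) (encode b y)
encode (fin n) i = i

decode : (a : U) → Fin (size a) → El a
decode 𝟙 _ = tt
decode bool Fin.zero = false
decode bool (Fin.suc _) = true
decode (a ⊕ b) i = Sum.map (decode a) (decode b) (splitAt (size a) i)
decode (a ⊗ b) i = Product.map (decode a) (decode b) (remQuot (size b) i)
decode (fin n) i = i

decode-encode : (a : U) (x : El a) → decode a (encode a x) ≡ x
decode-encode 𝟙 tt = refl
decode-encode bool false = refl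
decode-encode bool true = refl
decode-encode (a ⊕ b) (inj₁ x)
  rewrite splitAt-↑ˡ (size a) (encode a x) (size b) = cong inj₁ (decode-encode a x)
decode-encode (a ⊕ b) (inj₂ y)
  rewrite splitAt-↑ʳ (size a) (size b) (encode b y) = cong inj₂ (decode-encode b y)
decode-encode (a ⊗ b) (x , y) =
  trans (cong (Product.map (decode a) (decode b)) (remQuot-combine (encode a x) (encode b y)))
        (cong₂ _,_ (decode-encode a x) (decode-encode b y))
decode-encode (fin n) i = refl

-- Machines with structured states and symbols

-- The extra 𝟙 in the work alphabet is the blank, which encode sends to 0 as the machine model requires.
module StructuredNTM
  (StateCode SymbolCode : U) (start′ : El StateCode) (kindOf : El StateCode → Kind)
  (transitions : El StateCode → InSym → El (𝟙 ⊕ SymbolCode) →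
                 List⁺ (El StateCode × El (𝟙 ⊕ SymbolCode) × Move × Move))
  where

  State : Set
  State = El StateCode

  SymCode : U
  SymCode = 𝟙 ⊕ SymbolCode

  Sym : Set
  Sym = El SymCode

  Transition : Set
  Transition = State × Sym × Move × Move

  encodeTransition : Transition → Fin (size StateCode) × Fin (size SymCode) × Move × Move
  encodeTransition (q , g , mi , mw) = encode StateCode q , encode SymCode g , mi , mw

  M : NTM
  M = record
    { nStates = size StateCode
    ; nSyms   = size SymbolCode
    ; start   = encode StateCode start′
    ; kind    = λ q → kindOf (decode StateCode q)
    ; δ       = λ q s g → List⁺.map encodeTransition (transitions (decode StateCode q) s (decode SymCode g))
    }

  record Conf : Set where
    constructor conf
    field
      state : State
      ipos  : ℕ
      wpos  : ℕ
      tape  : ℕ → Sym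
  open Conf public

  write′ : (ℕ → Sym) → ℕ → Sym → (ℕ → Sym)
  write′ t p g j = if ⌊ j ℕ.≟ p ⌋ then g else t j

  step′ : Str → Conf → Transition → Conf
  step′ x c (q , g , mi , mw) =
    conf q (moveIn M x mi (ipos c)) (moveW M mw (wpos c)) (write′ (tape c) (wpos c) g)

  succs′ : Str → Conf → List Conf
  succs′ x c = List.map (step′ x c) (List⁺.toList (transitions (state c) (readIn M x (ipos c)) (tape c (wpos c))))

  Bounded′ : Str → ℕ → ℕ → Conf → Set
  Bounded′ x B zero    c with kindOf (state c)
  ... | running = ⊥
  ... | _       = wpos c ≤ B
  Bounded′ x B (suc t) c with kindOf (state c)
  ... | running = wpos c ≤ B × All (Bounded′ x B t) (succs′ x c)
  ... | _       = wpos c ≤ B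

  gap′ : Str → ℕ → Conf → ℤ
  gapList′ : Str → ℕ → List Conf → ℤ
  gap′ x t c with kindOf (state c)
  gap′ x t       c | accepting = + 1
  gap′ x t       c | rejecting = - (+ 1)
  gap′ x zero    c | running   = + 0
  gap′ x (suc t) c | running   = gapList′ x t (succs′ x c)
  gapList′ x t []       = + 0
  gapList′ x t (c ∷ cs) = gap′ x t c ℤ.+ gapList′ x t cs

  record Yields (x : Str) (B t : ℕ) (A : Conf) (g : ℤ) : Set where
    constructor yields
    field
      bounded : Bounded′ x B t A
      gap≡    : gap′ x t A ≡ g

  record YieldsAll (x : Str) (B t : ℕ) (As : List Conf) (g : ℤ) : Set where
    constructor yieldsAll
    field
      allBounded : All (Bounded′ x B t) As
      gapList≡   : gapList′ x t As ≡ g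

  Represents : Config M → Conf → Set
  Represents (cfg q i w T) A =
    q ≡ encode StateCode (state A) × i ≡ ipos A × w ≡ wpos A × (∀ j → T j ≡ encode SymCode (tape A j))

  encodeConf : Conf → Config M
  encodeConf A = cfg (encode StateCode (state A)) (ipos A) (wpos A) (λ j → encode SymCode (tape A j))

  encodeConf-represents : ∀ A → Represents (encodeConf A) A
  encodeConf-represents A = refl , refl , refl , λ j → refl

  kind-encode : ∀ q → NTM.kind M (encode StateCode q) ≡ kindOf q
  kind-encode q = cong kindOf (decode-encode StateCode q)

  write-represents : ∀ (T : ℕ → Fin (size SymCode)) (t : ℕ → Sym) p g → (∀ j → T j ≡ encode SymCode (t j)) →
    ∀ j → write M T p (encode SymCode g) j ≡ encode SymCode (write′ t p g j)
  write-represents T t p g e j with ⌊ j ℕ.≟ p ⌋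
  ... | true = refl
  ... | false = e j

  succs-represents : ∀ x C A → Represents C A → Pointwise Represents (succs M x C) (succs′ x A)
  succs-represents x (cfg _ _ _ T) A (refl , refl , refl , eT)
    rewrite eT (wpos A) | decode-encode StateCode (state A) | decode-encode SymCode (tape A (wpos A)) =
      go (List⁺.toList (transitions (state A) (readIn M x (ipos A)) (tape A (wpos A))))
    where
    go : ∀ τs → Pointwise Represents
      (List.map (λ { (q , g , mi , mw) → cfg q (moveIn M x mi (ipos A)) (moveW M mw (wpos A)) (write M T (wpos A) g) })
                (List.map encodeTransition τs))
      (List.map (step′ x A) τs)
    go [] = []
    go ((q , g , mi , mw) ∷ τs) = (refl , refl , refl , write-represents T (tape A) (wpos A) g eT) ∷ go τs

  gap-represents : ∀ x t C A → Represents C A → gap M x t C ≡ gap′ x t A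
  gapList-represents : ∀ x t Cs As → Pointwise Represents Cs As → gapList M x t Cs ≡ gapList′ x t As
  gap-represents x t C@(cfg _ _ _ _) A r@(refl , _)
    with NTM.kind M (encode StateCode (state A)) | kindOf (state A) | kind-encode (state A)
  ... | accepting | .accepting | refl = refl
  ... | rejecting | .rejecting | refl = refl
  gap-represents x zero    C A r | running | .running | refl = refl
  gap-represents x (suc t) C A r | running | .running | refl =
    gapList-represents x t _ _ (succs-represents x C A r)
  gapList-represents x t [] [] [] = refl
  gapList-represents x t (C ∷ Cs) (A ∷ As) (r ∷ rs) =
    cong₂ ℤ._+_ (gap-represents x t C A r) (gapList-represents x t Cs As rs)

  Bounded-represents : ∀ x B t C A → Represents C A → Bounded′ x B t A → Bounded M x B t C
  All-Bounded-represents : ∀ x B t Cs As → Pointwise Represents Cs As →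
    All (Bounded′ x B t) As → All (Bounded M x B t) Cs
  Bounded-represents x B zero C@(cfg _ _ _ _) A r@(refl , refl , refl , _) b
    with NTM.kind M (encode StateCode (state A)) | kindOf (state A) | kind-encode (state A)
  ... | accepting | .accepting | refl = b
  ... | rejecting | .rejecting | refl = b
  Bounded-represents x B (suc t) C@(cfg _ _ _ _) A r@(refl , refl , refl , _) b
    with NTM.kind M (encode StateCode (state A)) | kindOf (state A) | kind-encode (state A)
  ... | accepting | .accepting | refl = b
  ... | rejecting | .rejecting | refl = b
  ... | running | .running | refl =
    proj₁ b , All-Bounded-represents x B t _ _ (succs-represents x C A r) (proj₂ b)
  All-Bounded-represents x B t [] [] [] [] = []
  All-Bounded-represents x B t (C ∷ Cs) (A ∷ As) (r ∷ rs) (b ∷ bs) =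
    Bounded-represents x B t C A r b ∷ All-Bounded-represents x B t Cs As rs bs

  _≈_ : Conf → Conf → Set
  A ≈ A′ = state A ≡ state A′ × ipos A ≡ ipos A′ × wpos A ≡ wpos A′ × (∀ j → tape A j ≡ tape A′ j)

  ≈-refl : ∀ A → A ≈ A
  ≈-refl A = refl , refl , refl , λ j → refl

  ≈-sym : ∀ {A A′} → A ≈ A′ → A′ ≈ A
  ≈-sym (e₁ , e₂ , e₃ , e₄) = sym e₁ , sym e₂ , sym e₃ , λ j → sym (e₄ j)

  ≈-trans : ∀ {A A′ A″} → A ≈ A′ → A′ ≈ A″ → A ≈ A″
  ≈-trans (e₁ , e₂ , e₃ , e₄) (e₁′ , e₂′ , e₃′ , e₄′) =
    trans e₁ e₁′ , trans e₂ e₂′ , trans e₃ e₃′ , λ j → trans (e₄ j) (e₄′ j)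

  -- Both configurations are represented by the encoding of the first one.
  gap′-cong : ∀ x t A A′ → A ≈ A′ → gap′ x t A ≡ gap′ x t A′
  gap′-cong x t A A′ (e₁ , e₂ , e₃ , e₄) =
    trans (sym (gap-represents x t (encodeConf A) A (encodeConf-represents A)))
          (gap-represents x t (encodeConf A) A′ (cong (encode StateCode) e₁ , e₂ , e₃ , λ j → cong (encode SymCode) (e₄ j)))

  write′-cong : ∀ (t t′ : ℕ → Sym) p g → (∀ j → t j ≡ t′ j) → ∀ j → write′ t p g j ≡ write′ t′ p g j
  write′-cong t t′ p g e j with ⌊ j ℕ.≟ p ⌋
  ... | true = refl
  ... | false = e j

  write′-here : ∀ (t : ℕ → Sym) p g → write′ t p g p ≡ g
  write′-here t p g with p ℕ.≟ p
  ... | yes _ = refl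
  ... | no ne = ⊥-elim (ne refl)

  write′-other : ∀ (t : ℕ → Sym) p g j → ¬ j ≡ p → write′ t p g j ≡ t j
  write′-other t p g j ne with j ℕ.≟ p
  ... | yes e = ⊥-elim (ne e)
  ... | no _ = refl

  write′-self : ∀ (t : ℕ → Sym) p → ∀ j → write′ t p (t p) j ≡ t j
  write′-self t p j with j ℕ.≟ p
  ... | yes refl = refl
  ... | no _ = refl

  write′-same : ∀ (t : ℕ → Sym) p g → t p ≡ g → ∀ j → write′ t p g j ≡ t j
  write′-same t p .(t p) refl = write′-self t p

  write′-twice : ∀ (t : ℕ → Sym) p g g' → ∀ j → write′ (write′ t p g) p g' j ≡ write′ t p g' j
  write′-twice t p g g' j with j ℕ.≟ p
  ... | yes _ = refl
  ... | no _ = refl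

  succs′-cong : ∀ x A A′ → A ≈ A′ → Pointwise _≈_ (succs′ x A) (succs′ x A′)
  succs′-cong x (conf q i w t) (conf .q .i .w t′) (refl , refl , refl , e)
    rewrite e w = go (List⁺.toList (transitions q (readIn M x i) (t′ w)))
    where
    go : ∀ τs → Pointwise _≈_ (List.map (step′ x (conf q i w t)) τs) (List.map (step′ x (conf q i w t′)) τs)
    go [] = []
    go ((q , g , mi , mw) ∷ τs) = (refl , refl , refl , write′-cong t t′ w g e) ∷ go τs

  Bounded′-cong : ∀ x B t A A′ → A ≈ A′ → Bounded′ x B t A → Bounded′ x B t A′
  All-Bounded′-cong : ∀ x B t As As′ → Pointwise _≈_ As As′ → All (Bounded′ x B t) As → All (Bounded′ x B t) As′
  Bounded′-cong x B zero (conf q _ _ _) (conf .q _ _ _) (refl , refl , refl , _) b with kindOf q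
  ... | accepting = b
  ... | rejecting = b
  Bounded′-cong x B (suc t) A@(conf q _ _ _) A′@(conf .q _ _ _) e@(refl , refl , refl , _) b with kindOf q
  ... | accepting = b
  ... | rejecting = b
  ... | running = proj₁ b , All-Bounded′-cong x B t _ _ (succs′-cong x A A′ e) (proj₂ b)
  All-Bounded′-cong x B t [] [] [] [] = []
  All-Bounded′-cong x B t (A ∷ As) (A′ ∷ As′) (e ∷ es) (b ∷ bs) =
    Bounded′-cong x B t A A′ e b ∷ All-Bounded′-cong x B t As As′ es bs

  Bounded′-suc : ∀ x B t A → Bounded′ x B t A → Bounded′ x B (suc t) A × gap′ x (suc t) A ≡ gap′ x t A
  All-Bounded′-suc : ∀ x B t As → All (Bounded′ x B t) As →
    All (Bounded′ x B (suc t)) As × gapList′ x (suc t) As ≡ gapList′ x t As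
  Bounded′-suc x B zero A b with kindOf (state A)
  ... | accepting = b , refl
  ... | rejecting = b , refl
  Bounded′-suc x B (suc t) A b with kindOf (state A)
  ... | accepting = b , refl
  ... | rejecting = b , refl
  ... | running = (proj₁ b , proj₁ r) , proj₂ r
    where r = All-Bounded′-suc x B t (succs′ x A) (proj₂ b)
  All-Bounded′-suc x B t [] [] = [] , refl
  All-Bounded′-suc x B t (A ∷ As) (b ∷ bs) = (proj₁ r ∷ proj₁ rs) , cong₂ ℤ._+_ (proj₂ r) (proj₂ rs)
    where r  = Bounded′-suc x B t A b
          rs = All-Bounded′-suc x B t As bs

  Bounded′-raise : ∀ x B t t′ A → t ≤ t′ → Bounded′ x B t A → Bounded′ x B t′ A × gap′ x t′ A ≡ gap′ x t A
  Bounded′-raise x B t t′ A le b with NP.≤⇒≤′ le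
  ... | ℕ.≤′-refl = b , refl
  ... | ℕ.≤′-step {n} le′ = proj₁ m , trans (proj₂ m) (proj₂ r)
    where r = Bounded′-raise x B t n A (NP.≤′⇒≤ le′) b
          m = Bounded′-suc x B n A (proj₁ r)

  Bounded′-running : ∀ {x B t A} → kindOf (state A) ≡ running → wpos A ≤ B →
    All (Bounded′ x B t) (succs′ x A) → Bounded′ x B (suc t) A
  Bounded′-running {A = A} k w bs with kindOf (state A) | k
  ... | running | refl = w , bs

  gap′-running : ∀ {x t A} → kindOf (state A) ≡ running → gap′ x (suc t) A ≡ gapList′ x t (succs′ x A)
  gap′-running {A = A} k with kindOf (state A) | k
  ... | running | refl = refl

  module _ {x : Str} {B : ℕ} where

    Yields-≡ : ∀ {t A g g′} → g ≡ g′ → Yields x B t A g → Yields x B t A g′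
    Yields-≡ e (yields b y) = yields b (trans y e)

    Yields-raise : ∀ {t t′ A g} → t ≤ t′ → Yields x B t A g → Yields x B t′ A g
    Yields-raise {t} {t′} {A} le (yields b y) = yields (proj₁ r) (trans (proj₂ r) y)
      where r = Bounded′-raise x B t t′ A le b

    Yields-cong : ∀ {t A A′ g} → A ≈ A′ → Yields x B t A g → Yields x B t A′ g
    Yields-cong {t} {A} {A′} e (yields b y) = yields (Bounded′-cong x B t A A′ e b) (trans (sym (gap′-cong x t A A′ e)) y)

    Yields-running : ∀ {t A g} → kindOf (state A) ≡ running → wpos A ≤ B →
      YieldsAll x B t (succs′ x A) g → Yields x B (suc t) A g
    Yields-running k w (yieldsAll bs y) = yields (Bounded′-running k w bs) (trans (gap′-running k) y)

    YieldsAll-≡ : ∀ {t As g g′} → g ≡ g′ → YieldsAll x B t As g → YieldsAll x B t As g′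
    YieldsAll-≡ e (yieldsAll bs y) = yieldsAll bs (trans y e)

    YieldsAll-[] : ∀ {t} → YieldsAll x B t [] (+ 0)
    YieldsAll-[] = yieldsAll [] refl

    YieldsAll-∷ : ∀ {t A As g h} → Yields x B t A g → YieldsAll x B t As h → YieldsAll x B t (A ∷ As) (g ℤ.+ h)
    YieldsAll-∷ (yields b y) (yieldsAll bs ys) = yieldsAll (b ∷ bs) (cong₂ ℤ._+_ y ys)

    YieldsAll-++ : ∀ {t} As {As′ g h} → YieldsAll x B t As g → YieldsAll x B t As′ h →
      YieldsAll x B t (As ++ As′) (g ℤ.+ h)
    YieldsAll-++ [] {h = h} (yieldsAll [] refl) ys′ = YieldsAll-≡ (sym (ZP.+-identityˡ h)) ys′
    YieldsAll-++ {t} (A ∷ As) {h = h} (yieldsAll (b ∷ bs) refl) ys′ =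
      YieldsAll-≡ (sym (ZP.+-assoc (gap′ x t A) (gapList′ x t As) h))
        (YieldsAll-∷ (yields b refl) (YieldsAll-++ As (yieldsAll bs refl) ys′))

    YieldsAll-replicate : ∀ {t A g} k → Yields x B t A g → YieldsAll x B t (replicate k A) (+ k ℤ.* g)
    YieldsAll-replicate {g = g} zero y = YieldsAll-≡ (sym (ZP.*-zeroˡ g)) YieldsAll-[]
    YieldsAll-replicate {g = g} (suc k) y = YieldsAll-≡ (sym (ZP.suc-* (+ k) g)) (YieldsAll-∷ y (YieldsAll-replicate k y))

  data Run (x : Str) (B : ℕ) : ℕ → Conf → Conf → Set where
    done : ∀ {A A′} → A ≈ A′ → Run x B 0 A A′
    step : ∀ {n A A₁ A′} → kindOf (state A) ≡ running → wpos A ≤ B → succs′ x A ≡ A₁ ∷ [] →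
           Run x B n A₁ A′ → Run x B (suc n) A A′

  Run-Yields : ∀ {x B n s A A′ g} → Run x B n A A′ → Yields x B s A′ g → Yields x B (n + s) A g
  Run-Yields (done e) y = Yields-cong (≈-sym e) y
  Run-Yields {x} {B} {suc n} {s} {g = g} (step k w e r) y =
    Yields-running k w (subst (λ As → YieldsAll x B (n + s) As g) (sym e)
      (YieldsAll-≡ (ZP.+-identityʳ _) (YieldsAll-∷ (Run-Yields r y) YieldsAll-[])))

  Run-congˡ : ∀ {x B n A A′ A″} → A ≈ A′ → Run x B n A′ A″ → Run x B n A A″
  Run-congˡ e (done e′) = done (≈-trans e e′)
  Run-congˡ {x} {A = A} {A′} e (step k w s r) with singleton (subst (Pointwise _≈_ (succs′ x A)) s (succs′-cong x A A′ e))
    where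
    singleton : ∀ {As A₁} → Pointwise _≈_ As (A₁ ∷ []) → Σ Conf λ A₀ → As ≡ A₀ ∷ [] × A₀ ≈ A₁
    singleton (e₀ ∷ []) = _ , refl , e₀
  ... | _ , s′ , e₁ =
    step (trans (cong kindOf (proj₁ e)) k) (subst (_≤ _) (sym (proj₁ (proj₂ (proj₂ e)))) w) s′ (Run-congˡ e₁ r)

  Run-congʳ : ∀ {x B n A A′ A″} → Run x B n A A′ → A′ ≈ A″ → Run x B n A A″
  Run-congʳ (done e) e′ = done (≈-trans e e′)
  Run-congʳ (step k w s r) e′ = step k w s (Run-congʳ r e′)

  Run-++ : ∀ {x B n m A A′ A″} → Run x B n A A′ → Run x B m A′ A″ → Run x B (n + m) A A″
  Run-++ (done e) r₂ = Run-congˡ e r₂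
  Run-++ (step k w s r) r₂ = step k w s (Run-++ r r₂)

  swapKind : Kind → Kind
  swapKind accepting = rejecting
  swapKind rejecting = accepting
  swapKind running = running

  onState : (State → State) → Transition → Transition
  onState f (q , r) = f q , r

  module Negation (negState : State → State) (kind-negState : ∀ q → kindOf (negState q) ≡ swapKind (kindOf q))
    (transitions-negState : ∀ q s g → transitions (negState q) s g ≡ List⁺.map (onState negState) (transitions q s g))
    where

    negConf : Conf → Conf
    negConf (conf q i w t) = conf (negState q) i w t

    succs′-negConf : ∀ x A → succs′ x (negConf A) ≡ List.map negConf (succs′ x A)
    succs′-negConf x (conf q i w t)
      rewrite transitions-negState q (readIn M x i) (t w) = go (List⁺.toList (transitions q (readIn M x i) (t w)))
      where
      go : ∀ τs → List.map (step′ x (conf (negState q) i w t)) (List.map (onState negState) τs)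
                ≡ List.map negConf (List.map (step′ x (conf q i w t)) τs)
      go [] = refl
      go (_ ∷ τs) = cong (_ ∷_) (go τs)

    gap′-negConf : ∀ x t A → gap′ x t (negConf A) ≡ - gap′ x t A
    gapList′-negConf : ∀ x t As → gapList′ x t (List.map negConf As) ≡ - gapList′ x t As
    gap′-negConf x t A@(conf q _ _ _) with kindOf (negState q) | kindOf q | kind-negState q
    gap′-negConf x t       A | rejecting | accepting | refl = refl
    gap′-negConf x t       A | accepting | rejecting | refl = refl
    gap′-negConf x zero    A | running   | running   | refl = refl
    gap′-negConf x (suc t) A | running   | running   | refl =
      trans (cong (gapList′ x t) (succs′-negConf x A)) (gapList′-negConf x t (succs′ x A))
    gapList′-negConf x t [] = refl
    gapList′-negConf x t (A ∷ As) =
      trans (cong₂ ℤ._+_ (gap′-negConf x t A) (gapList′-negConf x t As))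
            (sym (ZP.neg-distrib-+ (gap′ x t A) (gapList′ x t As)))

    Bounded′-negConf : ∀ x B t A → Bounded′ x B t A → Bounded′ x B t (negConf A)
    All-Bounded′-negConf : ∀ x B t As → All (Bounded′ x B t) As → All (Bounded′ x B t) (List.map negConf As)
    Bounded′-negConf x B zero (conf q _ _ _) b with kindOf (negState q) | kindOf q | kind-negState q
    ... | rejecting | accepting | refl = b
    ... | accepting | rejecting | refl = b
    Bounded′-negConf x B (suc t) A@(conf q _ _ _) b with kindOf (negState q) | kindOf q | kind-negState q
    ... | rejecting | accepting | refl = b
    ... | accepting | rejecting | refl = b
    ... | running | running | refl =
      proj₁ b , subst (All (Bounded′ x B t)) (sym (succs′-negConf x A)) (All-Bounded′-negConf x B t _ (proj₂ b))
    All-Bounded′-negConf x B t [] [] = []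
    All-Bounded′-negConf x B t (A ∷ As) (b ∷ bs) = Bounded′-negConf x B t A b ∷ All-Bounded′-negConf x B t As bs

module InputReading (M : NTM) where
  readIn-∷ : ∀ b xs p → readIn M (b ∷ xs) (suc (suc p)) ≡ readIn M xs (suc p)
  readIn-∷ b xs p with suc p ℕ.<? suc (length xs) | p ℕ.<? length xs
  ... | yes _ | yes _ = refl
  ... | no _ | no _ = refl
  ... | yes q | no nq = ⊥-elim (nq (NP.≤-pred q))
  ... | no nq | yes q = ⊥-elim (nq (s≤s q))

  readIn-ones : ∀ r ys p → p < r + r → readIn M (dbl (replicate r true) ++ ys) (suc p) ≡ just true
  readIn-ones (suc r) ys zero lt = refl
  readIn-ones (suc r) ys (suc zero) lt = readIn-∷ true (true ∷ dbl (replicate r true) ++ ys) 0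
  readIn-ones (suc r) ys (suc (suc p)) lt = trans (readIn-∷ true _ (suc p)) (trans (readIn-∷ true _ p)
    (readIn-ones r ys p (NP.≤-pred (NP.≤-pred (subst (suc (suc (suc p)) ≤_) (cong suc (NP.+-suc r r)) lt)))))

  readIn-after-ones : ∀ r ys q → readIn M (dbl (replicate r true) ++ ys) (suc ((r + r) + q)) ≡ readIn M ys (suc q)
  readIn-after-ones zero ys q = refl
  readIn-after-ones (suc r) ys q =
    trans (cong (readIn M _) (shift r q)) (trans (readIn-∷ true _ _) (trans (readIn-∷ true _ _) (readIn-after-ones r ys q)))
    where
    shift : ∀ r q → suc (suc r + suc r + q) ≡ suc (suc (suc (r + r + q)))
    shift = ℕ-solve

  length-input : ∀ n c → length ⟨ replicate n true , c ∷ [] ⟩ ≡ (n + n) + 3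
  length-input zero c = refl
  length-input (suc n) c = trans (cong (λ z → suc (suc z)) (length-input n c)) (shift n)
    where
    shift : ∀ n → suc (suc (n + n + 3)) ≡ suc n + suc n + 3
    shift = ℕ-solve

-- Binary counters

increment : List Bool → List Bool
increment [] = true ∷ []
increment (false ∷ bs) = true ∷ bs
increment (true ∷ bs) = false ∷ increment bs

increments : ℕ → List Bool → List Bool
increments zero bs = bs
increments (suc c) bs = increments c (increment bs)

binary : ℕ → List Bool
binary n = increments n []

carries : List Bool → ℕ
carries (true ∷ bs) = suc (carries bs)
carries _ = 0

increments-increment : ∀ c bs → increments c (increment bs) ≡ increment (increments c bs)
increments-increment zero bs = refl
increments-increment (suc c) bs = increments-increment c (increment bs)

binary-suc : ∀ c → binary (suc c) ≡ increment (binary c)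
binary-suc c = increments-increment c []

increment²-∷ : ∀ b bs → increment (increment (b ∷ bs)) ≡ b ∷ increment bs
increment²-∷ false bs = refl
increment²-∷ true bs = refl

binary-suc-∷ : ∀ k → Σ Bool λ b → binary (suc k) ≡ b ∷ binary ⌊ suc k /2⌋
binary-suc-∷ zero = true , refl
binary-suc-∷ (suc zero) = false , refl
binary-suc-∷ (suc (suc k)) = Product.map₂ carry (binary-suc-∷ k)
  where
  h = ⌊ suc k /2⌋
  carry : ∀ {b} → binary (suc k) ≡ b ∷ binary h → binary (suc (suc (suc k))) ≡ b ∷ binary (suc h)
  carry {b} e = begin
    binary (suc (suc (suc k)))              ≡⟨ binary-suc (suc (suc k)) ⟩
    increment (binary (suc (suc k)))        ≡⟨ cong increment (binary-suc (suc k)) ⟩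
    increment (increment (binary (suc k)))  ≡⟨ cong (increment ∘ increment) e ⟩
    increment (increment (b ∷ binary h))    ≡⟨ increment²-∷ b (binary h) ⟩
    b ∷ increment (binary h)                ≡⟨ cong (b ∷_) (sym (binary-suc h)) ⟩
    b ∷ binary (suc h)                      ∎
    where open ≡-Reasoning

length-binary-suc : ∀ n → length (binary (suc n)) ≡ suc (length (binary ⌊ suc n /2⌋))
length-binary-suc n = cong length (proj₂ (binary-suc-∷ n))

length-increment : ∀ bs → length bs ≤ length (increment bs)
length-increment [] = z≤n
length-increment (false ∷ bs) = NP.≤-refl
length-increment (true ∷ bs) = s≤s (length-increment bs)

length-increments : ∀ c bs → length bs ≤ length (increments c bs)
length-increments zero bs = NP.≤-refl
length-increments (suc c) bs = NP.≤-trans (length-increment bs) (length-increments c (increment bs))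

length-increment≤ : ∀ bs → length (increment bs) ≤ suc (length bs)
length-increment≤ [] = s≤s z≤n
length-increment≤ (false ∷ bs) = NP.n≤1+n _
length-increment≤ (true ∷ bs) = s≤s (length-increment≤ bs)

length-increments≤ : ∀ c bs → length (increments c bs) ≤ c + length bs
length-increments≤ zero bs = NP.≤-refl
length-increments≤ (suc c) bs = NP.≤-trans (length-increments≤ c (increment bs))
  (subst (c + length (increment bs) ≤_) (NP.+-suc c (length bs)) (NP.+-monoʳ-≤ c (length-increment≤ bs)))

carries<length : ∀ bs → carries bs < length (increment bs)
carries<length [] = s≤s z≤n
carries<length (false ∷ bs) = s≤s z≤n
carries<length (true ∷ bs) = s≤s (carries<length bs)

2*⌊n/2⌋≤n : ∀ n → 2 * ⌊ n /2⌋ ≤ n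
2*⌊n/2⌋≤n n = subst (_≤ n) (cong (_+_ ⌊ n /2⌋) (sym (NP.+-identityʳ ⌊ n /2⌋)))
  (NP.≤-trans (NP.+-monoʳ-≤ ⌊ n /2⌋ (NP.⌊n/2⌋≤⌈n/2⌉ n)) (NP.≤-reflexive (NP.⌊n/2⌋+⌈n/2⌉≡n n)))

2^length-binary≤double : ∀ f k → k < f → 2 ^ length (binary (suc k)) ≤ 2 * suc k
2^length-binary≤double (suc f) k (s≤s lt) with binary-suc-∷ k
... | b , e rewrite e with ⌊ suc k /2⌋ in eq
... | zero = NP.*-monoʳ-≤ 2 (s≤s z≤n)
... | suc w = NP.*-monoʳ-≤ 2 (NP.≤-trans (2^length-binary≤double f w w<f) (subst (λ z → 2 * z ≤ suc k) eq (2*⌊n/2⌋≤n (suc k))))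
  where w<f : w < f
        w<f = NP.≤-trans (subst (_≤ k) eq (NP.≤-pred (NP.⌊n/2⌋<n k))) lt

-- Resource bounds

n<2^n : ∀ n → n < 2 ^ n
n<2^n zero = s≤s z≤n
n<2^n (suc n) = begin
    suc (suc n)
  ≤⟨ s≤s (NP.m≤n+m (suc n) n) ⟩
    suc n + suc n
  ≤⟨ NP.+-mono-≤ (n<2^n n) (n<2^n n) ⟩
    2 ^ n + 2 ^ n
  ≡⟨ cong (_+_ (2 ^ n)) (sym (NP.+-identityʳ (2 ^ n))) ⟩
    2 ^ suc n
  ∎
  where open NP.≤-Reasoning

-- The counting phase takes fewer than (Lx + 1)^5 steps, the evaluation phase at most
-- K^(m + 1) ≤ (Lx + 1)^(3K) steps because 2^m ≤ (Lx + 1)^2.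
timeBound : ∀ K Lx N m T → 1 ≤ Lx → m ≤ Lx → N ≤ Lx * (2 * m + 3) → 2 ^ m ≤ suc Lx ^ 2 → T ≤ K ^ suc m →
  N + 6 + T ≤ suc Lx ^ suc ((K + 2 * K) + 5)
timeBound K (suc l) N m T le ml Nb 2^m≤ T≤ = begin
    N + 6 + T
  ≤⟨ NP.+-mono-≤ p1 (NP.≤-trans T≤ p3) ⟩
    y ^ 5 + y ^ (K + 2 * K)
  ≤⟨ NP.+-mono-≤ (NP.^-monoʳ-≤ y (NP.m≤n+m 5 (K + 2 * K))) (NP.^-monoʳ-≤ y (NP.m≤m+n (K + 2 * K) 5)) ⟩
    y ^ E + y ^ E
  ≡⟨ cong (_+_ (y ^ E)) (sym (NP.+-identityʳ (y ^ E))) ⟩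
    2 * y ^ E
  ≤⟨ NP.*-mono-≤ 2≤y (NP.≤-refl {y ^ E}) ⟩
    y * y ^ E
  ∎
  where
  open NP.≤-Reasoning
  y = suc (suc l)
  E = (K + 2 * K) + 5
  2≤y : 2 ≤ y
  2≤y = s≤s (s≤s z≤n)
  p1 : N + 6 ≤ y ^ 5
  p1 = begin
      N + 6
    ≤⟨ NP.+-monoˡ-≤ 6 (NP.≤-trans Nb (NP.*-monoʳ-≤ (suc l) (NP.+-monoˡ-≤ 3 (NP.*-monoʳ-≤ 2 ml)))) ⟩
      suc l * (2 * suc l + 3) + 6
    ≤⟨ NP.m≤m+n _ (rest l) ⟩
      suc l * (2 * suc l + 3) + 6 + rest l
    ≡⟨ expand l ⟩
      y ^ 5
    ∎
    where
    -- rest z = (2 + z)^5 − (z + 1)(2z + 5) − 6, which has nonnegative coefficients.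
    rest : ℕ → ℕ
    rest z = z * z * z * z * z + 10 * (z * z * z * z) + 40 * (z * z * z) + 78 * (z * z) + 73 * z + 21
    expand : ∀ z → suc z * (2 * suc z + 3) + 6 + (z * z * z * z * z + 10 * (z * z * z * z) + 40 * (z * z * z) + 78 * (z * z) + 73 * z + 21)
                 ≡ (2 + z) * ((2 + z) * ((2 + z) * ((2 + z) * ((2 + z) * 1))))
    expand = ℕ-solve
  p2 : K ^ m ≤ (y ^ 2) ^ K
  p2 = begin
      K ^ m
    ≤⟨ NP.^-monoˡ-≤ m (NP.<⇒≤ (n<2^n K)) ⟩
      (2 ^ K) ^ m
    ≡⟨ trans (NP.^-*-assoc 2 K m) (trans (cong (2 ^_) (NP.*-comm K m)) (sym (NP.^-*-assoc 2 m K))) ⟩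
      (2 ^ m) ^ K
    ≤⟨ NP.^-monoˡ-≤ K 2^m≤ ⟩
      (y ^ 2) ^ K
    ∎
  p3 : K ^ suc m ≤ y ^ (K + 2 * K)
  p3 = begin
      K * K ^ m
    ≤⟨ NP.*-mono-≤ (NP.≤-trans (NP.<⇒≤ (n<2^n K)) (NP.^-monoˡ-≤ K 2≤y)) p2 ⟩
      y ^ K * (y ^ 2) ^ K
    ≡⟨ cong (y ^ K *_) (NP.^-*-assoc y 2 K) ⟩
      y ^ K * y ^ (2 * K)
    ≡⟨ sym (NP.^-distribˡ-+-* y K (2 * K)) ⟩
      y ^ (K + 2 * K)
    ∎

2*≤suc² : ∀ w → 2 * w ≤ suc w ^ 2
2*≤suc² w = subst (2 * w ≤_) (expand w) (NP.m≤m+n (2 * w) (w * w + 1))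
  where
  expand : ∀ w → 2 * w + (w * w + 1) ≡ (1 + w) * ((1 + w) * 1)
  expand = ℕ-solve

length-binary≤ : ∀ c Lx → c ≤ Lx → length (binary c) ≤ Lx
length-binary≤ c Lx le = NP.≤-trans (subst (length (binary c) ≤_) (NP.+-identityʳ c) (length-increments≤ c [])) le

2^length-binary≤square : ∀ c Lx → c ≤ Lx → 2 ^ length (binary c) ≤ suc Lx ^ 2
2^length-binary≤square zero Lx le = NP.m^n>0 (suc Lx) 2
2^length-binary≤square (suc c) Lx le = NP.≤-trans (2^length-binary≤double (suc c) c NP.≤-refl) (NP.≤-trans (NP.*-monoʳ-≤ 2 le) (2*≤suc² Lx))

length-binary≤log : ∀ c Lx → c ≤ Lx → length (binary c) ≤ suc ⌊log₂ Lx ⌋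
length-binary≤log zero Lx le = z≤n
length-binary≤log (suc c) (suc Lx) le = begin
    length (binary (suc c))
  ≡⟨ sym (⌊log₂[2^n]⌋≡n _) ⟩
    ⌊log₂ (2 ^ length (binary (suc c))) ⌋
  ≤⟨ ⌊log₂⌋-mono-≤ (NP.≤-trans (2^length-binary≤double (suc c) c NP.≤-refl) (NP.*-monoʳ-≤ 2 le)) ⟩
    ⌊log₂ (2 * suc Lx) ⌋
  ≡⟨ ⌊log₂[2*b]⌋≡1+⌊log₂b⌋ (suc Lx) ⟩
    suc ⌊log₂ suc Lx ⌋
  ∎
  where open NP.≤-Reasoning

module EvalTime (D : ℕ) where

  evalTime : ℕ → ℕ
  evalTime zero = 1
  evalTime (suc d) = suc ((D + D) * suc (evalTime d) + 1)

  termTime : ℕ → ℕ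
  termTime d = (D + D) * suc (evalTime d) + 1

  loopTime : ℕ → ℕ → ℕ
  loopTime d n = n * suc (evalTime d) + 1

  loopTime-suc : ∀ d n s → loopTime d (suc n) + s ≡ 1 + (evalTime d + (loopTime d n + s))
  loopTime-suc d n s = lemma (evalTime d) n s
    where
    lemma : ∀ T n s → suc n * suc T + 1 + s ≡ 1 + (T + (n * suc T + 1 + s))
    lemma = ℕ-solve

  growth : ℕ
  growth = 2 + (D + D)

  evalTime≤ : ∀ d → evalTime d ≤ growth ^ suc d
  evalTime≤ zero = s≤s z≤n
  evalTime≤ (suc d) = begin
      suc ((D + D) * suc (evalTime d) + 1)
    ≤⟨ s≤s (NP.+-monoˡ-≤ 1 (NP.*-monoʳ-≤ (D + D) (s≤s (evalTime≤ d)))) ⟩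
      suc ((D + D) * suc P + 1)
    ≡⟨ e₁ (D + D) P ⟩
      (D + D) * P + growth
    ≤⟨ NP.+-monoʳ-≤ ((D + D) * P) (NP.≤-trans (NP.m≤m*n growth (growth ^ d) ⦃ NP.m^n≢0 growth d ⦄) (NP.m≤m+n P P)) ⟩
      (D + D) * P + (P + P)
    ≡⟨ e₂ (D + D) P ⟩
      growth * P
    ∎
    where
    open NP.≤-Reasoning
    P = growth ^ suc d
    e₁ : ∀ a P → suc (a * suc P + 1) ≡ a * P + (2 + a)
    e₁ = ℕ-solve
    e₂ : ∀ a P → a * P + (P + P) ≡ (2 + a) * P
    e₂ = ℕ-solve

-- The machine

ControlCode : U
ControlCode = 𝟙 ⊕ 𝟙 ⊕ 𝟙 ⊕ 𝟙 ⊕ 𝟙 ⊕ 𝟙 ⊕ 𝟙 ⊕ 𝟙 ⊕ bool ⊕ 𝟙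

Control : Set
Control = El ControlCode

pattern Halt      = inj₁ tt
pattern Start     = inj₂ (inj₁ tt)
pattern Skip      = inj₂ (inj₂ (inj₁ tt))
pattern ScanPair  = inj₂ (inj₂ (inj₂ (inj₁ tt)))
pattern Increment = inj₂ (inj₂ (inj₂ (inj₂ (inj₁ tt))))
pattern Rewind    = inj₂ (inj₂ (inj₂ (inj₂ (inj₂ (inj₁ tt)))))
pattern SkipOne   = inj₂ (inj₂ (inj₂ (inj₂ (inj₂ (inj₂ (inj₁ tt))))))
pattern ReadBit   = inj₂ (inj₂ (inj₂ (inj₂ (inj₂ (inj₂ (inj₂ (inj₁ tt)))))))
pattern Eval c    = inj₂ (inj₂ (inj₂ (inj₂ (inj₂ (inj₂ (inj₂ (inj₂ (inj₁ c))))))))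
pattern Resume    = inj₂ (inj₂ (inj₂ (inj₂ (inj₂ (inj₂ (inj₂ (inj₂ (inj₂ tt))))))))

-- The Bool is a polarity: halting in polarity true rejects, so flipping it negates the gap.
StateCode : U
StateCode = bool ⊗ ControlCode

-- A frame b i j stands in for the counter bit b while a monomial X^i Y^j is being evaluated.
SymbolCode : ℕ → U
SymbolCode D = 𝟙 ⊕ bool ⊕ (bool ⊗ fin (suc D) ⊗ fin (suc D))

pattern blank       = inj₁ tt
pattern sentinel    = inj₂ (inj₁ tt)
pattern bit b       = inj₂ (inj₂ (inj₁ b))
pattern frame b i j = inj₂ (inj₂ (inj₂ (b , i , j)))

maxDegree : Poly2 → ℕ
maxDegree [] = 0
maxDegree ((c , i , j) ∷ ts) = i ⊔ j ⊔ maxDegree ts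

clamp : (D : ℕ) → ℕ → Fin (suc D)
clamp zero i = Fin.zero
clamp (suc D) zero = Fin.zero
clamp (suc D) (suc i) = Fin.suc (clamp D i)

posPart negPart : ℤ → ℕ
posPart (+ n) = n
posPart -[1+ n ] = 0
negPart (+ n) = 0
negPart -[1+ n ] = suc n

isTrue : InSym → Bool
isTrue (just true) = true
isTrue _ = false

isTrue-just : ∀ b → isTrue (just b) ≡ b
isTrue-just false = refl
isTrue-just true = refl

toℕ-clamp : ∀ D′ n → n ≤ D′ → toℕ (clamp D′ n) ≡ n
toℕ-clamp zero zero le = refl
toℕ-clamp (suc D′) zero le = refl
toℕ-clamp (suc D′) (suc n) (s≤s le) = cong suc (toℕ-clamp D′ n le)

DegreeBounded : ℕ → Poly2 → Set
DegreeBounded D ts = All (λ { (k , i , j) → i ≤ D × j ≤ D }) ts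

maxDegree-bounded : ∀ {D} ts → maxDegree ts ≤ D → DegreeBounded D ts
maxDegree-bounded [] le = []
maxDegree-bounded ((k , i , j) ∷ ts) le =
  (NP.m⊔n≤o⇒m≤o i j ij , NP.m⊔n≤o⇒n≤o i j ij) ∷ maxDegree-bounded ts (NP.m⊔n≤o⇒n≤o (i ⊔ j) (maxDegree ts) le)
  where ij = NP.m⊔n≤o⇒m≤o (i ⊔ j) (maxDegree ts) le

module Machine (u₀ u₁ : Poly2) (a₀ a₁ : ℤ) where

  D : ℕ
  D = maxDegree u₀ ⊔ maxDegree u₁

  open EvalTime D public

  poly : Bool → Poly2
  poly c = if c then u₁ else u₀

  base : Bool → ℤ
  base c = if c then a₁ else a₀

  value : Bool → ℕ → ℤ
  value c zero = base c
  value c (suc d) = eval2 (poly c) (value false d) (value true d)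

  poly-bounded : ∀ c → DegreeBounded D (poly c)
  poly-bounded false = maxDegree-bounded u₀ (NP.m≤m⊔n (maxDegree u₀) (maxDegree u₁))
  poly-bounded true = maxDegree-bounded u₁ (NP.m≤n⊔m (maxDegree u₀) (maxDegree u₁))

  Symbol : Set
  Symbol = El (𝟙 ⊕ SymbolCode D)

  -- (flip polarity?, next control state, symbol written, input move, work move)
  Choice : Set
  Choice = Bool × Control × Symbol × Move × Move

  returnChoice : Bool → Symbol → Choice
  returnChoice fb g = fb , Resume , g , S , L

  termChoices : Bool → Poly2 → List Choice
  termChoices b [] = []
  termChoices b ((k , i , j) ∷ ts) =
    replicate (posPart k) (false , Resume , frame b (clamp D i) (clamp D j) , S , S) ++
    replicate (negPart k) (true , Resume , frame b (clamp D i) (clamp D j) , S , S) ++ termChoices b ts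

  halt : Symbol → List⁺ Choice
  halt g = [ false , Halt , g , S , S ]

  -- In each Eval branching the two leading return branches cancel; they only keep the list nonempty.
  controlδ : Control → InSym → Symbol → List⁺ Choice
  controlδ Halt s g = halt g
  controlδ Start nothing g = halt g
  controlδ Start (just _) g = [ false , Skip , sentinel , R , S ]
  controlδ Skip s g = [ false , ScanPair , g , R , S ]
  controlδ ScanPair (just true) g = [ false , Increment , g , R , R ]
  controlδ ScanPair (just false) g = [ false , SkipOne , g , R , S ]
  controlδ ScanPair nothing g = [ false , SkipOne , g , R , S ]
  controlδ Increment s (bit true) = [ false , Increment , bit false , S , R ]
  controlδ Increment s (bit false) = [ false , Rewind , bit true , S , L ]
  controlδ Increment s blank = [ false , Rewind , bit true , S , L ]
  controlδ Increment s sentinel = halt sentinel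
  controlδ Increment s (frame b i j) = halt (frame b i j)
  controlδ Rewind s sentinel = [ false , ScanPair , sentinel , R , S ]
  controlδ Rewind s blank = [ false , Rewind , blank , S , L ]
  controlδ Rewind s (bit b) = [ false , Rewind , bit b , S , L ]
  controlδ Rewind s (frame b i j) = [ false , Rewind , frame b i j , S , L ]
  controlδ SkipOne s g = [ false , ReadBit , g , R , S ]
  controlδ ReadBit s g = [ false , Eval (isTrue s) , g , S , R ]
  controlδ (Eval c) s blank = returnChoice false blank ∷ (returnChoice true blank ∷
    replicate (posPart (base c)) (returnChoice false blank) ++ replicate (negPart (base c)) (returnChoice true blank))
  controlδ (Eval c) s (bit b) = returnChoice false (bit b) ∷ (returnChoice true (bit b) ∷ termChoices b (poly c))
  controlδ (Eval c) s sentinel = halt sentinel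
  controlδ (Eval c) s (frame b i j) = halt (frame b i j)
  controlδ Resume s (frame b (Fin.suc k) j) = [ false , Eval false , frame b (inject₁ k) j , S , R ]
  controlδ Resume s (frame b Fin.zero (Fin.suc k)) = [ false , Eval true , frame b Fin.zero (inject₁ k) , S , R ]
  controlδ Resume s (frame b Fin.zero Fin.zero) = [ returnChoice false (bit b) ]
  controlδ Resume s blank = halt blank
  controlδ Resume s sentinel = halt sentinel
  controlδ Resume s (bit b) = halt (bit b)

  flipIf : Bool → Bool → Bool
  flipIf fb p = if fb then not p else p

  withPolarity : Bool → Choice → El StateCode × Symbol × Move × Move
  withPolarity p (fb , k , r) = (flipIf fb p , k) , r

  transitions : El StateCode → InSym → Symbol → List⁺ (El StateCode × Symbol × Move × Move)
  transitions (p , k) s g = List⁺.map (withPolarity p) (controlδ k s g)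

  kindOf : El StateCode → Kind
  kindOf (p , Halt) = if p then rejecting else accepting
  kindOf (p , inj₂ _) = running

  open StructuredNTM StateCode (SymbolCode D) (false , Start) kindOf transitions public

  negState : State → State
  negState (p , k) = not p , k

  kind-negState : ∀ q → kindOf (negState q) ≡ swapKind (kindOf q)
  kind-negState (false , Halt) = refl
  kind-negState (true , Halt) = refl
  kind-negState (p , inj₂ _) = refl

  withPolarity-not : ∀ p ch → withPolarity (not p) ch ≡ onState negState (withPolarity p ch)
  withPolarity-not p (false , _) = refl
  withPolarity-not p (true , _) = refl

  transitions-negState : ∀ q s g → transitions (negState q) s g ≡ List⁺.map (onState negState) (transitions q s g)
  transitions-negState (p , k) s g = begin
    List⁺.map (withPolarity (not p)) (controlδ k s g)           ≡⟨ List⁺ₚ.map-cong (withPolarity-not p) (controlδ k s g) ⟩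
    List⁺.map (onState negState ∘ withPolarity p) (controlδ k s g) ≡⟨ List⁺ₚ.map-∘ (controlδ k s g) ⟩
    List⁺.map (onState negState) (List⁺.map (withPolarity p) (controlδ k s g)) ∎
    where open ≡-Reasoning

  open Negation negState kind-negState transitions-negState public

-- Evaluating the recursion

module Evaluation (u₀ u₁ : Poly2) (a₀ a₁ : ℤ) (x : Str) (B : ℕ) where
  open Machine u₀ u₁ a₀ a₁

  Word : (ℕ → Symbol) → ℕ → ℕ → Set
  Word t q zero = t q ≡ blank
  Word t q (suc d) = Σ Bool (λ b → t q ≡ bit b) × Word t (suc q) d

  Word-write′ : ∀ d (t : ℕ → Symbol) p g q → p < q → Word t q d → Word (write′ t p g) q d
  Word-write′ zero t p g q lt w = trans (write′-other t p g q (λ e → NP.<-irrefl (sym e) lt)) w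
  Word-write′ (suc d) t p g q lt ((b , e) , w) =
    (b , trans (write′-other t p g q (λ e → NP.<-irrefl (sym e) lt)) e) ,
    Word-write′ d t p g (suc q) (NP.m<n⇒m<1+n lt) w

  succs′-at : ∀ A g → tape A (wpos A) ≡ g →
    succs′ x A ≡ List.map (step′ x A) (List⁺.toList (transitions (state A) (readIn M x (ipos A)) g))
  succs′-at A g e = cong (λ g′ → List.map (step′ x A) (List⁺.toList (transitions (state A) (readIn M x (ipos A)) g′))) e

  succs′-reading : ∀ A r → readIn M x (ipos A) ≡ r →
    succs′ x A ≡ List.map (step′ x A) (List⁺.toList (transitions (state A) r (tape A (wpos A))))
  succs′-reading A r e = cong (λ r′ → List.map (step′ x A) (List⁺.toList (transitions (state A) r′ (tape A (wpos A))))) e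

  succs′-Eval : ∀ c p i h t g → t (suc h) ≡ g →
    succs′ x (conf (p , Eval c) i (suc h) t)
      ≡ List.map (step′ x (conf (p , Eval c) i (suc h) t) ∘ withPolarity p) (List⁺.toList (controlδ (Eval c) (readIn M x i) g))
  succs′-Eval c p i h t g e = trans (succs′-at (conf (p , Eval c) i (suc h) t) g e) (sym (LP.map-∘ (List⁺.toList (controlδ (Eval c) (readIn M x i) g))))

  module _ {s : ℕ} (F : Choice → Conf) where

    YieldsAll-map-++ : ∀ chs chs′ {g h} → YieldsAll x B s (List.map F chs) g → YieldsAll x B s (List.map F chs′) h →
      YieldsAll x B s (List.map F (chs ++ chs′)) (g ℤ.+ h)
    YieldsAll-map-++ chs chs′ {g} {h} ys ys′ =
      subst (λ As → YieldsAll x B s As (g ℤ.+ h)) (sym (LP.map-++ F chs chs′)) (YieldsAll-++ (List.map F chs) ys ys′)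

    YieldsAll-map-replicate : ∀ k ch {g} → Yields x B s (F ch) g → YieldsAll x B s (List.map F (replicate k ch)) (+ k ℤ.* g)
    YieldsAll-map-replicate k ch {g} y =
      subst (λ As → YieldsAll x B s As (+ k ℤ.* g)) (sym (LP.map-replicate F k ch)) (YieldsAll-replicate k y)

  signed : Bool → ℤ → ℤ
  signed fb z = if fb then - z else z

  posPart-negPart : ∀ z → + posPart z ℤ.- + negPart z ≡ z
  posPart-negPart (+ n) = ZP.+-identityʳ (+ n)
  posPart-negPart -[1+ n ] = refl

  return-signed : ∀ fb p i h t s → Bounded′ x B s (conf (p , Resume) i h t) →
    Yields x B s (conf (flipIf fb p , Resume) i h t) (signed fb (gap′ x s (conf (p , Resume) i h t)))
  return-signed false p i h t s b = yields b refl
  return-signed true p i h t s b = yields (Bounded′-negConf x B s (conf (p , Resume) i h t) b) (gap′-negConf x s (conf (p , Resume) i h t))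

  return-child : ∀ fb p i h t g s s′ → s ≤ s′ → t (suc h) ≡ g → Bounded′ x B s (conf (p , Resume) i h t) →
    Yields x B s′ (conf (flipIf fb p , Resume) i h (write′ t (suc h) g)) (signed fb (gap′ x s (conf (p , Resume) i h t)))
  return-child fb p i h t g s s′ le eg b =
    Yields-cong (refl , refl , refl , λ j → sym (write′-same t (suc h) g eg j))
      (Yields-raise le (return-signed fb p i h t s b))

  eval-correct : ∀ d c p i h (t : ℕ → Symbol) s → Word t (suc h) d → suc h + d ≤ B →
    Bounded′ x B s (conf (p , Resume) i h t) →
    Yields x B (evalTime d + s) (conf (p , Eval c) i (suc h) t) (value c d ℤ.* gap′ x s (conf (p , Resume) i h t))

  monomial-correct : ∀ d p i h (t : ℕ → Symbol) b (ri rj : Fin (suc D)) m₁ m₂ s → toℕ ri ≡ m₁ → toℕ rj ≡ m₂ →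
    t (suc h) ≡ frame b ri rj → Word t (suc (suc h)) d → suc (suc h) + d ≤ B →
    Bounded′ x B s (conf (p , Resume) i h (write′ t (suc h) (bit b))) →
    Yields x B (loopTime d (m₁ + m₂) + s) (conf (p , Resume) i (suc h) t)
      ((value false d ℤ.^ m₁ ℤ.* value true d ℤ.^ m₂) ℤ.* gap′ x s (conf (p , Resume) i h (write′ t (suc h) (bit b))))

  eval-correct zero c p i h t s w sp bR =
    Yields-running refl (NP.≤-trans (NP.m≤m+n (suc h) 0) sp)
      (subst (λ As → YieldsAll x B s As (base c ℤ.* gR)) (sym (succs′-Eval c p i h t blank w))
        (YieldsAll-≡ (trans (alg gR (+ posPart (base c)) (+ negPart (base c))) (cong (ℤ._* gR) (posPart-negPart (base c))))
          (YieldsAll-∷ (ret false) (YieldsAll-∷ (ret true)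
            (YieldsAll-map-++ F (replicate (posPart (base c)) _) (replicate (negPart (base c)) _)
              (YieldsAll-map-replicate F (posPart (base c)) _ (ret false))
              (YieldsAll-map-replicate F (negPart (base c)) _ (ret true)))))))
    where
    E = conf (p , Eval c) i (suc h) t
    gR = gap′ x s (conf (p , Resume) i h t)
    F : Choice → Conf
    F ch = step′ x E (withPolarity p ch)
    ret : ∀ fb → Yields x B s (F (returnChoice fb blank)) (signed fb gR)
    ret fb = return-child fb p i h t blank s s NP.≤-refl w bR
    alg : ∀ (g P N : ℤ) → g ℤ.+ (- g ℤ.+ (P ℤ.* g ℤ.+ N ℤ.* (- g))) ≡ (P ℤ.- N) ℤ.* g
    alg = ℤ-solve
  eval-correct (suc d) c p i h t s ((b , eb) , w) sp bR =
    Yields-running refl (NP.≤-trans (NP.m≤m+n (suc h) (suc d)) sp)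
      (subst (λ As → YieldsAll x B s′ As (eval2 (poly c) X Y ℤ.* gR)) (sym (succs′-Eval c p i h t (bit b) eb))
        (YieldsAll-≡ (alg gR (eval2 (poly c) X Y))
          (YieldsAll-∷ (ret false) (YieldsAll-∷ (ret true) (terms (poly c) (poly-bounded c))))))
    where
    E = conf (p , Eval c) i (suc h) t
    gR = gap′ x s (conf (p , Resume) i h t)
    s′ = termTime d + s
    X = value false d
    Y = value true d
    F : Choice → Conf
    F ch = step′ x E (withPolarity p ch)
    ret : ∀ fb → Yields x B s′ (F (returnChoice fb (bit b))) (signed fb gR)
    ret fb = return-child fb p i h t (bit b) s s′ (NP.m≤n+m s (termTime d)) eb bR
    monomial : ∀ fb i′ j′ → i′ ≤ D → j′ ≤ D →
      Yields x B s′ (F (fb , Resume , frame b (clamp D i′) (clamp D j′) , S , S)) ((X ℤ.^ i′ ℤ.* Y ℤ.^ j′) ℤ.* signed fb gR)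
    monomial fb i′ j′ bi bj =
      Yields-raise (NP.+-monoˡ-≤ s (NP.+-monoˡ-≤ 1 (NP.*-monoˡ-≤ (suc (evalTime d)) (NP.+-mono-≤ bi bj))))
        (Yields-≡ (cong ((X ℤ.^ i′ ℤ.* Y ℤ.^ j′) ℤ.*_) (trans (sym (gap′-cong x s _ _ eqv)) (Yields.gap≡ r)))
          (monomial-correct d (flipIf fb p) i h t₁ b (clamp D i′) (clamp D j′) i′ j′ s (toℕ-clamp D i′ bi) (toℕ-clamp D j′ bj)
            (write′-here t (suc h) _) (Word-write′ d t (suc h) _ (suc (suc h)) NP.≤-refl w)
            (subst (_≤ B) (NP.+-suc (suc h) d) sp) (Bounded′-cong x B s _ _ eqv (Yields.bounded r))))
      where
      t₁ = write′ t (suc h) (frame b (clamp D i′) (clamp D j′))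
      r = return-signed fb p i h t s bR
      eqv : conf (flipIf fb p , Resume) i h t ≈ conf (flipIf fb p , Resume) i h (write′ t₁ (suc h) (bit b))
      eqv = refl , refl , refl , λ j → sym (trans (write′-twice t (suc h) _ (bit b) j) (write′-same t (suc h) (bit b) eb j))
    terms : ∀ ts → DegreeBounded D ts → YieldsAll x B s′ (List.map F (termChoices b ts)) (eval2 ts X Y ℤ.* gR)
    terms [] [] = YieldsAll-≡ (sym (ZP.*-zeroˡ gR)) YieldsAll-[]
    terms ((k , i′ , j′) ∷ ts) ((bi , bj) ∷ bs) =
      YieldsAll-≡ (trans (alg′ (+ posPart k) (+ negPart k) (X ℤ.^ i′) (Y ℤ.^ j′) (eval2 ts X Y) gR)
                         (cong (λ k′ → (k′ ℤ.* X ℤ.^ i′ ℤ.* Y ℤ.^ j′ ℤ.+ eval2 ts X Y) ℤ.* gR) (posPart-negPart k)))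
        (YieldsAll-map-++ F (replicate (posPart k) _) _ (YieldsAll-map-replicate F (posPart k) _ (monomial false i′ j′ bi bj))
          (YieldsAll-map-++ F (replicate (negPart k) _) _ (YieldsAll-map-replicate F (negPart k) _ (monomial true i′ j′ bi bj))
            (terms ts bs)))
      where
      alg′ : ∀ (P N A C Z g : ℤ) →
        P ℤ.* ((A ℤ.* C) ℤ.* g) ℤ.+ (N ℤ.* ((A ℤ.* C) ℤ.* (- g)) ℤ.+ Z ℤ.* g) ≡ ((P ℤ.- N) ℤ.* A ℤ.* C ℤ.+ Z) ℤ.* g
      alg′ = ℤ-solve
    alg : ∀ (g Z : ℤ) → g ℤ.+ (- g ℤ.+ Z ℤ.* g) ≡ Z ℤ.* g
    alg = ℤ-solve

  frame-within : ∀ h d → suc (suc h) + d ≤ B → suc h ≤ B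
  frame-within h d sp = NP.≤-trans (NP.n≤1+n (suc h)) (NP.≤-trans (NP.m≤m+n (suc (suc h)) d) sp)

  next-factor : ∀ d c p i h (t : ℕ → Symbol) g s {v} →
    succs′ x (conf (p , Resume) i (suc h) t) ≡ conf (p , Eval c) i (suc (suc h)) (write′ t (suc h) g) ∷ [] →
    Word (write′ t (suc h) g) (suc (suc h)) d → suc (suc h) + d ≤ B →
    Yields x B s (conf (p , Resume) i (suc h) (write′ t (suc h) g)) v →
    Yields x B (1 + (evalTime d + s)) (conf (p , Resume) i (suc h) t) (value c d ℤ.* v)
  next-factor d c p i h t g s e w sp (yields b y) =
    Run-Yields (step refl (frame-within h d sp) e (done (≈-refl _)))
      (Yields-≡ (cong (value c d ℤ.*_) y) (eval-correct d c p i (suc h) (write′ t (suc h) g) s w sp b))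

  monomial-correct d p i h t b Fin.zero Fin.zero zero zero s e₁ e₂ et w sp bR =
    Yields-≡ (sym (ZP.*-identityˡ _))
      (Run-Yields (step refl (frame-within h d sp) (succs′-at (conf (p , Resume) i (suc h) t) (frame b Fin.zero Fin.zero) et) (done (≈-refl _)))
        (yields bR refl))
  monomial-correct d p i h t b Fin.zero rj (suc m) m₂ s () e₂ et w sp bR
  monomial-correct d p i h t b Fin.zero (Fin.suc k) zero zero s e₁ () et w sp bR
  monomial-correct d p i h t b (Fin.suc k) rj zero m₂ s () e₂ et w sp bR
  monomial-correct d p i h t b (Fin.suc k) rj (suc m) m₂ s e₁ e₂ et w sp bR =
    subst (λ τ → Yields x B τ (conf (p , Resume) i (suc h) t) ((value false d ℤ.^ suc m ℤ.* value true d ℤ.^ m₂) ℤ.* gR′))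
      (sym (loopTime-suc d (m + m₂) s))
      (Yields-≡ (alg (value false d) (value false d ℤ.^ m) (value true d ℤ.^ m₂) _)
        (next-factor d false p i h t g (loopTime d (m + m₂) + s) (succs′-at (conf (p , Resume) i (suc h) t) (frame b (Fin.suc k) rj) et) w₁ sp
          (Yields-≡ (cong ((value false d ℤ.^ m ℤ.* value true d ℤ.^ m₂) ℤ.*_) (gap′-cong x s R″ R′ R″≈R′))
            (monomial-correct d p i h (write′ t (suc h) g) b (inject₁ k) rj m m₂ s
              (trans (toℕ-inject₁ k) (NP.suc-injective e₁)) e₂ (write′-here t (suc h) g) w₁ sp
              (Bounded′-cong x B s R′ R″ (≈-sym R″≈R′) bR)))))
    where
    g = frame b (inject₁ k) rj
    R′ = conf (p , Resume) i h (write′ t (suc h) (bit b))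
    R″ = conf (p , Resume) i h (write′ (write′ t (suc h) g) (suc h) (bit b))
    R″≈R′ : R″ ≈ R′
    R″≈R′ = refl , refl , refl , write′-twice t (suc h) g (bit b)
    gR′ = gap′ x s R′
    w₁ = Word-write′ d t (suc h) g (suc (suc h)) NP.≤-refl w
    alg : ∀ (v A C g : ℤ) → v ℤ.* ((A ℤ.* C) ℤ.* g) ≡ ((v ℤ.* A) ℤ.* C) ℤ.* g
    alg = ℤ-solve
  monomial-correct d p i h t b Fin.zero (Fin.suc k) zero (suc m) s e₁ e₂ et w sp bR =
    subst (λ τ → Yields x B τ (conf (p , Resume) i (suc h) t) ((value false d ℤ.^ zero ℤ.* value true d ℤ.^ suc m) ℤ.* gR′))
      (sym (loopTime-suc d m s))
      (Yields-≡ (alg (value true d) (value true d ℤ.^ m) _)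
        (next-factor d true p i h t g (loopTime d m + s) (succs′-at (conf (p , Resume) i (suc h) t) (frame b Fin.zero (Fin.suc k)) et) w₁ sp
          (Yields-≡ (cong ((ℤ.+ 1 ℤ.* value true d ℤ.^ m) ℤ.*_) (gap′-cong x s R″ R′ R″≈R′))
            (monomial-correct d p i h (write′ t (suc h) g) b Fin.zero (inject₁ k) zero m s
              refl (trans (toℕ-inject₁ k) (NP.suc-injective e₂)) (write′-here t (suc h) g) w₁ sp
              (Bounded′-cong x B s R′ R″ (≈-sym R″≈R′) bR)))))
    where
    g = frame b Fin.zero (inject₁ k)
    R′ = conf (p , Resume) i h (write′ t (suc h) (bit b))
    R″ = conf (p , Resume) i h (write′ (write′ t (suc h) g) (suc h) (bit b))
    R″≈R′ : R″ ≈ R′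
    R″≈R′ = refl , refl , refl , write′-twice t (suc h) g (bit b)
    gR′ = gap′ x s R′
    w₁ = Word-write′ d t (suc h) g (suc (suc h)) NP.≤-refl w
    alg : ∀ (v A g : ℤ) → v ℤ.* ((ℤ.+ 1 ℤ.* A) ℤ.* g) ≡ (ℤ.+ 1 ℤ.* (v ℤ.* A)) ℤ.* g
    alg = ℤ-solve

-- Counting the input

module Counting (u₀ u₁ : Poly2) (a₀ a₁ : ℤ) (x : Str) (B : ℕ) where
  open Machine u₀ u₁ a₀ a₁
  open Evaluation u₀ u₁ a₀ a₁ x B

  Lx : ℕ
  Lx = length x

  advance : ℕ → ℕ
  advance i = moveIn M x R i

  counterCells : List Bool → ℕ → Symbol
  counterCells [] j = blank
  counterCells (b ∷ bs) zero = bit b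
  counterCells (b ∷ bs) (suc j) = counterCells bs j

  counterTape : List Bool → ℕ → Symbol
  counterTape bs zero = sentinel
  counterTape bs (suc j) = counterCells bs j

  counterCells-cong : ∀ pre (s1 s2 : List Bool) → (∀ j → ¬ j ≡ 0 → counterCells s1 j ≡ counterCells s2 j) →
    ∀ j → ¬ j ≡ length pre → counterCells (pre ++ s1) j ≡ counterCells (pre ++ s2) j
  counterCells-cong [] s1 s2 h j ne = h j ne
  counterCells-cong (p ∷ pre) s1 s2 h zero ne = refl
  counterCells-cong (p ∷ pre) s1 s2 h (suc j) ne = counterCells-cong pre s1 s2 h j (λ e → ne (cong suc e))

  counterCells-bit : ∀ l p → p < length l → Σ Bool λ b → counterCells l p ≡ bit b
  counterCells-bit (b ∷ l) zero lt = b , refl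
  counterCells-bit (b ∷ l) (suc p) (s≤s lt) = counterCells-bit l p lt

  replicate-++-∷ : ∀ k (l : List Bool) → replicate k false ++ false ∷ l ≡ false ∷ (replicate k false ++ l)
  replicate-++-∷ zero l = refl
  replicate-++-∷ (suc k) l = cong (false ∷_) (replicate-++-∷ k l)

  counterCells-offset : ∀ k s → counterCells (replicate k false ++ s) k ≡ counterCells s 0
  counterCells-offset zero s = refl
  counterCells-offset (suc k) s = counterCells-offset k s

  write′-counterTape : ∀ (t : ℕ → Symbol) k s1 s2 b → (∀ j → t j ≡ counterTape (replicate k false ++ s1) j) →
    (∀ j → ¬ j ≡ 0 → counterCells s1 j ≡ counterCells s2 j) → counterCells s2 0 ≡ bit b →
    ∀ j → write′ t (suc k) (bit b) j ≡ counterTape (replicate k false ++ s2) j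
  write′-counterTape t k s1 s2 b ht h hb j with j ℕ.≟ suc k
  ... | yes refl = sym (trans (counterCells-offset k s2) hb)
  ... | no ne = trans (ht j) (unchanged j ne)
    where
    unchanged : ∀ j → ¬ j ≡ suc k → counterTape (replicate k false ++ s1) j ≡ counterTape (replicate k false ++ s2) j
    unchanged zero ne = refl
    unchanged (suc j) ne = counterCells-cong (replicate k false) s1 s2 h j (λ e → ne (cong suc (trans e (LP.length-replicate k))))

  run-increment : ∀ bs k ipos (t : ℕ → Symbol) → (∀ j → t j ≡ counterTape (replicate k false ++ bs) j) →
    k + length (increment bs) ≤ B →
    Run x B (suc (carries bs)) (conf (false , Increment) ipos (suc k) t)
                               (conf (false , Rewind) ipos (k + carries bs) (counterTape (replicate k false ++ increment bs)))
  run-increment [] k ipos t ht sp =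
    step refl (subst (_≤ B) (NP.+-comm k 1) sp)
      (succs′-at (conf (false , Increment) ipos (suc k) t) blank (trans (ht (suc k)) (counterCells-offset k [])))
      (done (refl , refl , sym (NP.+-identityʳ k) ,
             write′-counterTape t k [] (true ∷ []) true ht (λ { zero ne → ⊥-elim (ne refl) ; (suc j) ne → refl }) refl))
  run-increment (false ∷ bs) k ipos t ht sp =
    step refl (NP.≤-trans (subst (_≤ k + suc (length bs)) (NP.+-comm k 1) (NP.+-monoʳ-≤ k (s≤s z≤n))) sp)
      (succs′-at (conf (false , Increment) ipos (suc k) t) (bit false) (trans (ht (suc k)) (counterCells-offset k (false ∷ bs))))
      (done (refl , refl , sym (NP.+-identityʳ k) ,
             write′-counterTape t k (false ∷ bs) (true ∷ bs) true ht (λ { zero ne → ⊥-elim (ne refl) ; (suc j) ne → refl }) refl))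
  run-increment (true ∷ bs) k ipos t ht sp =
    step refl (NP.≤-trans (subst (_≤ k + suc (length (increment bs))) (NP.+-comm k 1) (NP.+-monoʳ-≤ k (s≤s z≤n))) sp)
      (succs′-at (conf (false , Increment) ipos (suc k) t) (bit true) (trans (ht (suc k)) (counterCells-offset k (true ∷ bs))))
      (Run-congʳ (run-increment bs (suc k) ipos t′ ht′ (subst (_≤ B) (NP.+-suc k (length (increment bs))) sp))
        (refl , refl , sym (NP.+-suc k (carries bs)) ,
         λ j → cong (λ l → counterTape l j) (sym (replicate-++-∷ k (increment bs)))))
    where
    t′ = write′ t (suc k) (bit false)
    ht′ : ∀ j → t′ j ≡ counterTape (replicate (suc k) false ++ bs) j
    ht′ j = trans (write′-counterTape t k (true ∷ bs) (false ∷ bs) false ht (λ { zero ne → ⊥-elim (ne refl) ; (suc j) ne → refl }) refl j)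
                  (cong (λ l → counterTape l j) (replicate-++-∷ k bs))

  run-rewind : ∀ p ipos (t : ℕ → Symbol) l → (∀ j → t j ≡ counterTape l j) → p ≤ length l → p ≤ B →
    Run x B (suc p) (conf (false , Rewind) ipos p t) (conf (false , ScanPair) (advance ipos) 0 (counterTape l))
  run-rewind zero ipos t l ht le sp =
    step refl z≤n (succs′-at (conf (false , Rewind) ipos 0 t) sentinel (ht 0))
      (done (refl , refl , refl , λ j → trans (write′-same t 0 sentinel (ht 0) j) (ht j)))
  run-rewind (suc p) ipos t l ht le sp with counterCells-bit l p le
  ... | b , eb =
    step refl sp (succs′-at (conf (false , Rewind) ipos (suc p) t) (bit b) (trans (ht (suc p)) eb))
      (run-rewind p ipos (write′ t (suc p) (bit b)) l
        (λ j → trans (write′-same t (suc p) (bit b) (trans (ht (suc p)) eb) j) (ht j))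
        (NP.≤-trans (NP.n≤1+n p) le) (NP.≤-trans (NP.n≤1+n p) sp))

  readIn-just⇒≤ : ∀ i b → readIn M x i ≡ just b → i ≤ Lx
  readIn-just⇒≤ zero b ()
  readIn-just⇒≤ (suc i) b e with i ℕ.<? length x
  ... | yes p = p
  readIn-just⇒≤ (suc i) b () | no _

  advance-suc : ∀ i → i ≤ Lx → advance i ≡ suc i
  advance-suc i le with i ℕ.<? suc Lx
  ... | yes _ = refl
  ... | no ne = ⊥-elim (ne (s≤s le))

  advance-≥ : ∀ i → i ≤ advance i
  advance-≥ i with i ℕ.<? suc Lx
  ... | yes _ = NP.n≤1+n i
  ... | no _ = NP.≤-refl

  countPairs : ℕ → ℕ → ℕ
  countPairsAt : ℕ → ℕ → InSym → ℕ
  countPairs zero i = 0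
  countPairs (suc f) i = countPairsAt f i (readIn M x i)
  countPairsAt f i (just true) = suc (countPairs f (advance (advance i)))
  countPairsAt f i _ = 0

  scanEnd : ℕ → ℕ → ℕ
  scanEndAt : ℕ → ℕ → InSym → ℕ
  scanEnd zero i = advance i
  scanEnd (suc f) i = scanEndAt f i (readIn M x i)
  scanEndAt f i (just true) = scanEnd f (advance (advance i))
  scanEndAt f i _ = advance i

  countPairs≤ : ∀ f i → countPairs f i ≤ f
  countPairs≤ zero i = z≤n
  countPairs≤ (suc f) i with readIn M x i
  ... | just true = s≤s (countPairs≤ f (advance (advance i)))
  ... | just false = z≤n
  ... | nothing = z≤n

  countPairsFrom : ℕ → ℕ → InSym → ℕ
  countPairsFrom zero i r = 0
  countPairsFrom (suc f) i r = countPairsAt f i r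
  scanEndFrom : ℕ → ℕ → InSym → ℕ
  scanEndFrom zero i r = advance i
  scanEndFrom (suc f) i r = scanEndAt f i r

  run-stop : ∀ i (t : ℕ → Symbol) bs r → readIn M x i ≡ r → (∀ j → t j ≡ counterTape bs j) →
    transitions (false , ScanPair) r (t 0) ≡ [ (false , SkipOne) , t 0 , R , S ] →
    Run x B 1 (conf (false , ScanPair) i 0 t) (conf (false , SkipOne) (advance i) 0 (counterTape bs))
  run-stop i t bs r eq ht e =
    step refl z≤n (trans (succs′-reading (conf (false , ScanPair) i 0 t) r eq) (cong (List.map _ ∘ List⁺.toList) e))
      (done (refl , refl , refl , λ j → trans (write′-self t 0 j) (ht j)))

  run-scan : ∀ f i bs (t : ℕ → Symbol) → Lx < f + i → (∀ j → t j ≡ counterTape bs j) →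
    length (increments (countPairs f i) bs) ≤ B →
    Σ ℕ λ N → N ≤ f * (2 * length (increments (countPairs f i) bs) + 3) ×
      Run x B (suc N) (conf (false , ScanPair) i 0 t)
                      (conf (false , SkipOne) (scanEnd f i) 0 (counterTape (increments (countPairs f i) bs)))
  run-scan-at : ∀ f i bs (t : ℕ → Symbol) r → readIn M x i ≡ r → Lx < f + i → (∀ j → t j ≡ counterTape bs j) →
    length (increments (countPairsFrom f i r) bs) ≤ B →
    Σ ℕ λ N → N ≤ f * (2 * length (increments (countPairsFrom f i r) bs) + 3) ×
      Run x B (suc N) (conf (false , ScanPair) i 0 t)
                      (conf (false , SkipOne) (scanEndFrom f i r) 0 (counterTape (increments (countPairsFrom f i r) bs)))
  run-scan zero i bs t lt ht sp = run-scan-at zero i bs t (readIn M x i) refl lt ht sp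
  run-scan (suc f) i bs t lt ht sp = run-scan-at (suc f) i bs t (readIn M x i) refl lt ht sp
  run-scan-at zero i bs t (just true) eq lt ht sp = ⊥-elim (NP.<-irrefl refl (NP.<-≤-trans lt (readIn-just⇒≤ i true eq)))
  run-scan-at (suc f) i bs t (just true) eq lt ht sp =
    cost + (cost + suc (proj₁ IH)) , steps≤ ,
    step refl z≤n (succs′-reading (conf (false , ScanPair) i 0 t) (just true) eq)
      (Run-++ (run-increment bs 0 (advance i) (write′ t 0 (t 0)) (λ j → trans (write′-self t 0 j) (ht j)) within₁)
        (Run-++ (run-rewind (carries bs) (advance i) (counterTape (increment bs)) (increment bs) (λ j → refl)
                  (NP.<⇒≤ (carries<length bs)) within₂)
          (proj₂ (proj₂ IH))))
    where
    ℓ = length (increments (countPairs f (advance (advance i))) (increment bs))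
    cost = suc (carries bs)
    grows : length (increment bs) ≤ ℓ
    grows = length-increments (countPairs f (advance (advance i))) (increment bs)
    within₁ : 0 + length (increment bs) ≤ B
    within₁ = NP.≤-trans grows sp
    within₂ : carries bs ≤ B
    within₂ = NP.<⇒≤ (NP.<-≤-trans (carries<length bs) within₁)
    lt′ : Lx < f + advance (advance i)
    lt′ = NP.<-≤-trans lt (subst (_≤ f + advance (advance i)) (NP.+-suc f i)
            (NP.+-monoʳ-≤ f (subst (_≤ advance (advance i)) (advance-suc i (readIn-just⇒≤ i true eq)) (advance-≥ (advance i)))))
    IH = run-scan f (advance (advance i)) (increment bs) (counterTape (increment bs)) lt′ (λ j → refl) sp
    cost≤ : cost ≤ suc ℓ
    cost≤ = s≤s (NP.<⇒≤ (NP.<-≤-trans (carries<length bs) grows))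
    steps≤ : cost + (cost + suc (proj₁ IH)) ≤ suc f * (2 * ℓ + 3)
    steps≤ = subst (cost + (cost + suc (proj₁ IH)) ≤_) (sym (NP.*-distribʳ-+ (2 * ℓ + 3) 1 f))
      (subst (_≤ 1 * (2 * ℓ + 3) + f * (2 * ℓ + 3)) (regroup cost (proj₁ IH))
        (NP.+-mono-≤ (subst (cost + cost + 1 ≤_) (expand ℓ) (NP.+-mono-≤ (NP.+-mono-≤ cost≤ cost≤) (NP.≤-refl {1})))
                     (proj₁ (proj₂ IH))))
      where
      regroup : ∀ a n → a + a + 1 + n ≡ a + (a + suc n)
      regroup = ℕ-solve
      expand : ∀ L → suc L + suc L + 1 ≡ 1 * (2 * L + 3)
      expand = ℕ-solve
  run-scan-at zero    i bs t (just false) eq lt ht sp = 0 , z≤n , run-stop i t bs _ eq ht refl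
  run-scan-at (suc f) i bs t (just false) eq lt ht sp = 0 , z≤n , run-stop i t bs _ eq ht refl
  run-scan-at zero    i bs t nothing      eq lt ht sp = 0 , z≤n , run-stop i t bs _ eq ht refl
  run-scan-at (suc f) i bs t nothing      eq lt ht sp = 0 , z≤n , run-stop i t bs _ eq ht refl

  readIn-first : 1 ≤ Lx → Σ Bool λ b → readIn M x 1 ≡ just b
  readIn-first le with 0 ℕ.<? length x
  ... | yes p = _ , refl
  ... | no ne = ⊥-elim (ne le)

  Word-counterCells : ∀ l (t : ℕ → Symbol) q → (∀ j → t (q + j) ≡ counterCells l j) → Word t q (length l)
  Word-counterCells [] t q h = trans (cong t (sym (NP.+-identityʳ q))) (h 0)
  Word-counterCells (b ∷ l) t q h = (b , trans (cong t (sym (NP.+-identityʳ q))) (h 0)) ,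
    Word-counterCells l t (suc q) (λ j → trans (cong t (sym (NP.+-suc q j))) (h (suc j)))

  initConf : Conf
  initConf = conf (false , Start) 1 0 (λ _ → blank)

  -- The scan starts at the second pair 11, so on ⟨ 1ⁿ , c ⟩ it counts n − 1 pairs.
  scanStart count scanStop : ℕ
  scanStart = advance (advance 1)
  count = countPairs Lx scanStart
  scanStop = scanEnd Lx scanStart

  counter : List Bool
  counter = binary count

  m : ℕ
  m = length counter

  bitRead : Bool
  bitRead = isTrue (readIn M x (advance scanStop))

  evalConf : Conf
  evalConf = conf (false , Eval bitRead) (advance scanStop) 1 (counterTape counter)

  run-count : 1 ≤ Lx → m ≤ B → Σ ℕ λ N → N ≤ Lx * (2 * m + 3) × Run x B (2 + (suc N + 2)) initConf evalConf
  run-count le sp with readIn-first le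
  ... | b , eb =
    proj₁ scan , proj₁ (proj₂ scan) ,
    step refl z≤n (succs′-reading initConf (just b) eb)
      (step refl z≤n refl
        (Run-++ (proj₂ (proj₂ scan))
          (step refl z≤n refl (step refl z≤n refl
            (done (refl , refl , refl , λ j → trans (write′-self (write′ (counterTape counter) 0 (counterTape counter 0)) 0 j)
                                                    (write′-self (counterTape counter) 0 j)))))))
    where
    sentinelTape : ℕ → Symbol
    sentinelTape = write′ (λ _ → blank) 0 sentinel
    sentinelTape-empty : ∀ j → write′ sentinelTape 0 (sentinelTape 0) j ≡ counterTape [] j
    sentinelTape-empty zero = refl
    sentinelTape-empty (suc j) = refl
    scanStart≥1 : 1 ≤ scanStart
    scanStart≥1 = NP.≤-trans (advance-≥ 1) (advance-≥ (advance 1))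
    scan = run-scan Lx scanStart [] (write′ sentinelTape 0 (sentinelTape 0))
             (subst (Lx <_) (NP.+-comm scanStart Lx) (NP.+-mono-≤ scanStart≥1 (NP.≤-refl {Lx}))) sentinelTape-empty sp

  run-all : (le : 1 ≤ Lx) → (sp : suc m ≤ B) →
    let N = proj₁ (run-count le (NP.≤-trans (NP.n≤1+n m) sp)) in
    Yields x B ((2 + (suc N + 2)) + (evalTime m + 1)) initConf (value bitRead m)
  run-all le sp =
    Run-Yields (proj₂ (proj₂ (run-count le (NP.≤-trans (NP.n≤1+n m) sp))))
      (Yields-≡ (ZP.*-identityʳ (value bitRead m))
        (eval-correct m bitRead false (advance scanStop) 0 (counterTape counter) 1
          (Word-counterCells counter (counterTape counter) 1 (λ j → refl)) sp (z≤n , (z≤n ∷ []))))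

  Bounded′-emptyInput : Lx ≡ 0 → Bounded′ x B 1 initConf
  Bounded′-emptyInput e with readIn M x 1 in eq
  ... | nothing = z≤n , (z≤n ∷ [])
  ... | just b = ⊥-elim (NP.<-irrefl (sym e) (readIn-just⇒≤ 1 b eq))

  countPairs-ones : ∀ r f i → (∀ j → j < r → readIn M x (i + (j + j)) ≡ just true) → readIn M x (i + (r + r)) ≡ just false →
    i + (r + r) ≤ Lx → r ≤ f → countPairs f i ≡ r × scanEnd f i ≡ suc (i + (r + r))
  countPairs-ones zero zero i ht hf le rf =
    refl , trans (advance-suc i (subst (_≤ Lx) (NP.+-identityʳ i) le)) (cong suc (sym (NP.+-identityʳ i)))
  countPairs-ones zero (suc f) i ht hf le rf =
    cong (countPairsAt f i) e₀ ,
    trans (cong (scanEndAt f i) e₀) (trans (advance-suc i (subst (_≤ Lx) (NP.+-identityʳ i) le)) (cong suc (sym (NP.+-identityʳ i))))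
    where e₀ = trans (cong (readIn M x) (sym (NP.+-identityʳ i))) hf
  countPairs-ones (suc r) (suc f) i ht hf le (s≤s rf) =
    trans (cong (countPairsAt f i) e₀) (cong suc (trans (cong (countPairs f) two-steps) (proj₁ IH))) ,
    trans (cong (scanEndAt f i) e₀) (trans (cong (scanEnd f) two-steps) (trans (proj₂ IH) (cong suc (shift i r))))
    where
    e₀ = trans (cong (readIn M x) (sym (NP.+-identityʳ i))) (ht 0 (s≤s z≤n))
    shift : ∀ i r → suc (suc i) + (r + r) ≡ i + (suc r + suc r)
    shift = ℕ-solve
    i<Lx : suc i ≤ Lx
    i<Lx = NP.≤-trans (subst (_≤ i + (suc r + suc r)) (NP.+-comm i 1) (NP.+-monoʳ-≤ i (s≤s z≤n))) le
    two-steps : advance (advance i) ≡ suc (suc i)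
    two-steps = trans (cong advance (advance-suc i (NP.<⇒≤ i<Lx))) (advance-suc (suc i) i<Lx)
    IH = countPairs-ones r f (suc (suc i)) (λ j lt → trans (cong (readIn M x) (shift i j)) (ht (suc j) (s≤s lt)))
           (trans (cong (readIn M x) (shift i r)) hf) (subst (_≤ Lx) (sym (shift i r)) le) rf

module Construction (u₀ u₁ : Poly2) (a₀ a₁ : ℤ) where
  open Machine u₀ u₁ a₀ a₁
  open InputReading M

  k : ℕ
  k = suc ((growth + 2 * growth) + 5)

  f : Str → ℤ
  f x = gap M x (timeB k (length x)) (initial M)

  module OnInput (x : Str) where
    B T : ℕ
    B = spaceB k (length x)
    T = timeB k (length x)
    open Counting u₀ u₁ a₀ a₁ x B public
    open Evaluation u₀ u₁ a₀ a₁ x B public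

    initial-represents : Represents (initial M) initConf
    initial-represents = refl , refl , refl , λ j → refl

    count≤ : count ≤ Lx
    count≤ = countPairs≤ Lx scanStart

    counter-within-space : suc m ≤ B
    counter-within-space = begin
        suc m
      ≤⟨ s≤s (length-binary≤log count Lx count≤) ⟩
        suc (suc ⌊log₂ Lx ⌋)
      ≤⟨ s≤s (NP.m≤n+m (suc ⌊log₂ Lx ⌋) ⌊log₂ Lx ⌋) ⟩
        suc ⌊log₂ Lx ⌋ + suc ⌊log₂ Lx ⌋
      ≡⟨ cong (_+_ (suc ⌊log₂ Lx ⌋)) (sym (NP.+-identityʳ _)) ⟩
        2 * suc ⌊log₂ Lx ⌋
      ≤⟨ NP.*-monoˡ-≤ (suc ⌊log₂ Lx ⌋) {2} {k} (s≤s (s≤s z≤n)) ⟩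
        k * suc ⌊log₂ Lx ⌋
      ∎
      where open NP.≤-Reasoning

    initConf-yields : 1 ≤ Lx → Yields x B T initConf (value bitRead m)
    initConf-yields le = Yields-raise within-time (run-all le counter-within-space)
      where
      run = run-count le (NP.≤-trans (NP.n≤1+n m) counter-within-space)
      N = proj₁ run
      steps≡ : ∀ a b → (2 + (suc a + 2)) + (b + 1) ≡ a + 6 + b
      steps≡ = ℕ-solve
      within-time : (2 + (suc N + 2)) + (evalTime m + 1) ≤ T
      within-time = subst (_≤ T) (sym (steps≡ N (evalTime m)))
        (timeBound growth Lx N m (evalTime m) le (length-binary≤ count Lx count≤) (proj₁ (proj₂ run))
          (2^length-binary≤square count Lx count≤) (evalTime≤ m))

  initial-bounded : ∀ x → Bounded M x (spaceB k (length x)) (timeB k (length x)) (initial M)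
  initial-bounded [] =
    Bounded-represents [] B T (initial M) initConf initial-represents
      (proj₁ (Bounded′-raise [] B 1 T initConf (NP.m^n>0 1 k) (Bounded′-emptyInput refl)))
    where open OnInput []
  initial-bounded x@(_ ∷ _) =
    Bounded-represents x B T (initial M) initConf initial-represents (Yields.bounded (initConf-yields (s≤s z≤n)))
    where open OnInput x

  f-GapL : GapL f
  f-GapL = M , k , λ x → initial-bounded x , refl

  module UnaryInput (n : ℕ) (c : Bool) where
    x : Str
    x = ⟨ ones (suc n) , bitStr c ⟩
    open OnInput x public

    length-x : Lx ≡ (suc n + suc n) + 3
    length-x = length-input (suc n) c

    within-x : ∀ a → a ≤ (suc n + suc n) + 3 → a ≤ Lx
    within-x a h = subst (a ≤_) (sym length-x) h

    1≤Lx : 1 ≤ Lx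
    1≤Lx = within-x 1 (s≤s z≤n)

    scanStart≡3 : scanStart ≡ 3
    scanStart≡3 = trans (cong advance (advance-suc 1 1≤Lx)) (advance-suc 2 (within-x 2 (NP.≤-trans (NP.n≤1+n 2) (NP.m≤n+m 3 (suc n + suc n)))))

    pairs-ones : ∀ j → j < n → readIn M x (3 + (j + j)) ≡ just true
    pairs-ones j lt = readIn-ones (suc n) _ (2 + (j + j))
      (s≤s (NP.≤-trans (subst (_≤ n + n) (cong suc (NP.+-suc j j)) (NP.+-mono-≤ lt lt)) (NP.+-monoʳ-≤ n (NP.n≤1+n n))))

    separator : readIn M x (3 + (n + n)) ≡ just false
    separator = trans (cong (readIn M x) (eq n)) (readIn-after-ones (suc n) _ 0)
      where
      eq : ∀ n → 3 + (n + n) ≡ suc (suc n + suc n + 0)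
      eq = ℕ-solve

    counted : countPairs Lx 3 ≡ n × scanEnd Lx 3 ≡ suc (3 + (n + n))
    counted = countPairs-ones n Lx 3 pairs-ones separator
      (within-x _ (subst (3 + (n + n) ≤_) (eq n) (NP.m≤m+n (3 + (n + n)) 2)))
      (within-x n (NP.≤-trans (NP.m≤m+n n (suc n)) (NP.≤-trans (NP.n≤1+n _) (NP.m≤m+n _ 3))))
      where
      eq : ∀ n → 3 + (n + n) + 2 ≡ suc n + suc n + 3
      eq = ℕ-solve

    m≡ : m ≡ length (binary n)
    m≡ = cong (λ z → length (binary z)) (trans (cong (countPairs Lx) scanStart≡3) (proj₁ counted))

    bitRead≡c : bitRead ≡ c
    bitRead≡c = trans (cong (λ z → isTrue (readIn M x z)) (trans (cong advance (trans (cong (scanEnd Lx) scanStart≡3) (proj₂ counted)))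
                                                        (advance-suc _ (within-x _ (subst (4 + (n + n) ≤_) (eq₁ n) (NP.m≤m+n _ 1))))))
                 (trans (cong (λ z → isTrue (readIn M x z)) (eq₂ n))
                        (trans (cong isTrue (readIn-after-ones (suc n) _ 2)) (isTrue-just c)))
      where
      eq₁ : ∀ n → 4 + (n + n) + 1 ≡ suc n + suc n + 3
      eq₁ = ℕ-solve
      eq₂ : ∀ n → suc (suc (3 + (n + n))) ≡ suc (suc n + suc n + 2)
      eq₂ = ℕ-solve

  f-unary : ∀ n c → f ⟨ ones (suc n) , bitStr c ⟩ ≡ value c (length (binary n))
  f-unary n c = begin
      gap M x T (initial M)  ≡⟨ gap-represents x T (initial M) initConf initial-represents ⟩
      gap′ x T initConf      ≡⟨ Yields.gap≡ (initConf-yields 1≤Lx) ⟩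
      value bitRead m             ≡⟨ cong₂ value bitRead≡c m≡ ⟩
      value c (length (binary n)) ∎
    where
    open UnaryInput n c
    open ≡-Reasoning

lemma1 : (u₀ u₁ : Poly2) (a₀ a₁ : ℤ) →
    Σ (Str → ℤ) λ f → GapL f ×
      (∀ (n : ℕ) → 1 ≤ n → ∀ (c : Bool) →
        (2 ≤ n → f ⟨ ones n , bitStr c ⟩ ≡
           eval2 (if c then u₁ else u₀)
                 (f ⟨ ones ⌈ n /2⌉ , bitStr false ⟩)
                 (f ⟨ ones ⌈ n /2⌉ , bitStr true ⟩))
        × (n ≡ 1 → f ⟨ ones n , bitStr c ⟩ ≡ (if c then a₁ else a₀)))
lemma1 u₀ u₁ a₀ a₁ = f , f-GapL , λ n _ c → halving n c , base-case n c
  where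
  open Construction u₀ u₁ a₀ a₁
  open Machine u₀ u₁ a₀ a₁ using (value)

  halving : ∀ n c → 2 ≤ n → f ⟨ ones n , bitStr c ⟩ ≡
    eval2 (if c then u₁ else u₀) (f ⟨ ones ⌈ n /2⌉ , bitStr false ⟩) (f ⟨ ones ⌈ n /2⌉ , bitStr true ⟩)
  halving (suc zero) c (s≤s ())
  halving (suc (suc n)) c _ = begin
    f ⟨ ones (2 + n) , bitStr c ⟩
      ≡⟨ f-unary (suc n) c ⟩
    value c (length (binary (suc n)))
      ≡⟨ cong (value c) (length-binary-suc n) ⟩
    eval2 (if c then u₁ else u₀) (value false ℓ) (value true ℓ)
      ≡⟨ sym (cong₂ (eval2 (if c then u₁ else u₀)) (f-unary h false) (f-unary h true)) ⟩
    eval2 (if c then u₁ else u₀) (f ⟨ ones (suc h) , bitStr false ⟩) (f ⟨ ones (suc h) , bitStr true ⟩) ∎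
    where
    open ≡-Reasoning
    h = ⌊ suc n /2⌋
    ℓ = length (binary h)

  base-case : ∀ n c → n ≡ 1 → f ⟨ ones n , bitStr c ⟩ ≡ (if c then a₁ else a₀)
  base-case .1 c refl = f-unary 0 c
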